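{- Let $t$ be an odd positive integer and $\pi$ any partition, with $t$-core $\pi_{t\text{ -core}}$, integers $n_0,\dots,n_{t-1}$ and $t$-quotient $(\hat\pi_0,\dots,\hat\pi_{t-1})$ as defined in the context. Then $$\mathrm{BG\text{ - }rank}(\pi)=\mathrm{BG\text{ - }rank}(\pi_{t\text{ -core}})+\sum_{j=0}^{t-1}(-1)^{j+n_j}\,\mathrm{BG\text{ - }rank}(\hat\pi_j).$$
   Context: For a partition $\pi=(\lambda_1\ge\lambda_2\ge\cdots)$ (with $\lambda_i=0$ for $i$ beyond the number of parts), $\mathrm{BG\text{ - }rank}(\pi)=\sum_{i\ge1}(-1)^{i+1}\frac{1-(-1)^{\lambda_i}}{2}$. The $t$-core $\pi_{t\text{ -core}}$ of $\pi$ is the partition obtained from $\pi$ by successively removing rim hooks of length $t$ until none remain (it is independent of the choices). Set $\beta_i=\lambda_i-i$ for $i\ge1$ and $B=\{\beta_i: i\ge1\}$. For $k\in\{0,\dots,t-1\}$ let $s_1<s_2<s_3<\cdots$ be the integers $r$ with $t(r-1)+k\notin B$ (this set is bounded below and contains all sufficiently large integers). Then there is a unique integer $n_k$ with $s_m=n_k+m$ for all sufficiently large $m$, and $\hat\pi_k$ is the partition whose parts are the nonzero numbers among $n_k+m-s_m$, $m\ge1$ (these are nonincreasing and nonnegative). The $t$-tuple $(\hat\pi_0,\dots,\hat\pi_{t-1})$ is the $t$-quotient of $\pi$, and $(n_0,\dots,n_{t-1})$ has sum $0$. -}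

module Defs where

open import Data.Nat as ℕ using (ℕ; zero; suc; _%_)
open import Data.Integer as ℤ using (ℤ; +_; -_; _+_; _-_; _*_; ∣_∣)
open import Data.Fin using (Fin; toℕ) renaming (zero to fzero; suc to fsuc)
open import Data.List using (List; []; _∷_)
open import Data.Product using (Σ; ∃; _×_; _,_)
open import Data.Sum using (_⊎_)
open import Relation.Nullary using (¬_)
open import Relation.Binary.PropositionalEquality using (_≡_)
open import Relation.Binary.Construct.Closure.ReflexiveTransitive using (Star)

data IsPartition : List ℕ → Set where
  nil  : IsPartition []
  one  : ∀ {x} → 0 ℕ.< x → IsPartition (x ∷ [])
  cons : ∀ {x y ys} → y ℕ.≤ x → IsPartition (y ∷ ys) → IsPartition (x ∷ y ∷ ys)

-- part λ i = λ_{i+1}  (0-indexed), 0 beyond the number of parts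
part : List ℕ → ℕ → ℕ
part []       _       = 0
part (x ∷ xs) zero    = x
part (x ∷ xs) (suc i) = part xs i

size : List ℕ → ℕ
size []       = 0
size (x ∷ xs) = x ℕ.+ size xs

Odd : ℕ → Set
Odd t = t % 2 ≡ 1

negOnePowℕ : ℕ → ℤ
negOnePowℕ zero    = + 1
negOnePowℕ (suc n) = - negOnePowℕ n

negOnePow : ℤ → ℤ
negOnePow z = negOnePowℕ ∣ z ∣

sumFin : (n : ℕ) → (Fin n → ℤ) → ℤ
sumFin zero    f = + 0
sumFin (suc n) f = f fzero + sumFin n (λ j → f (fsuc j))

-- BG-rank: Σ_{i≥1} (-1)^{i+1} (1-(-1)^{λ_i})/2 ; with 0-indexed i the
-- sign is (-1)^i, and (1-(-1)^{λ})/2 = λ mod 2.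

bgFrom : ℕ → List ℕ → ℤ
bgFrom i []       = + 0
bgFrom i (x ∷ xs) = negOnePowℕ i * + (x % 2) + bgFrom (suc i) xs

BGrank : List ℕ → ℤ
BGrank = bgFrom 0

-- Young diagrams, skew shapes, rim hooks.  Cell (i , j): row i, column j
-- (both 0-indexed); (i , j) ∈ λ iff j < λ_{i+1}.

Cell : Set
Cell = ℕ × ℕ

InShape : List ℕ → Cell → Set
InShape la (i , j) = j ℕ.< part la i

InSkew : List ℕ → List ℕ → Cell → Set
InSkew la mu c = InShape la c × ¬ InShape mu c

Adjacent : Cell → Cell → Set
Adjacent (i , j) (i' , j') =
  (i ≡ i' × (j' ≡ suc j ⊎ j ≡ suc j')) ⊎ (j ≡ j' × (i' ≡ suc i ⊎ i ≡ suc i'))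

SkewStep : List ℕ → List ℕ → Cell → Cell → Set
SkewStep la mu c d = InSkew la mu c × InSkew la mu d × Adjacent c d

RemoveRimHook : ℕ → List ℕ → List ℕ → Set
RemoveRimHook t la mu =
  IsPartition mu ×
  (∀ i → part mu i ℕ.≤ part la i) ×
  size la ≡ size mu ℕ.+ t ×
  (∀ c d → InSkew la mu c → InSkew la mu d → Star (SkewStep la mu) c d) ×
  (∀ i j → ¬ (InSkew la mu (i , j) × InSkew la mu (suc i , j) ×
              InSkew la mu (i , suc j) × InSkew la mu (suc i , suc j)))

IsTCoreOf : ℕ → List ℕ → List ℕ → Set
IsTCoreOf t pi ka = Star (RemoveRimHook t) pi ka × (∀ mu → ¬ RemoveRimHook t ka mu)

InBeta : List ℕ → ℤ → Set
InBeta la x = ∃ λ i → (+ part la i) - (+ suc i) ≡ x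

InS : ℕ → List ℕ → ℕ → ℤ → Set
InS t la k r = ¬ InBeta la ((+ t) * (r - + 1) + + k)

-- s is the increasing enumeration s_1 < s_2 < … of that set;
-- s m stands for s_{m+1}.
IsEnumeration : ℕ → List ℕ → ℕ → (ℕ → ℤ) → Set
IsEnumeration t la k s =
  (∀ m → s m ℤ.< s (suc m)) ×
  (∀ r → (InS t la k r → ∃ λ m → s m ≡ r) × (∀ m → s m ≡ r → InS t la k r))

IsShift : (ℕ → ℤ) → ℤ → Set
IsShift s n = ∃ λ N → ∀ m → N ℕ.≤ m → s m ≡ n + + suc m

IsQuotientPart : (ℕ → ℤ) → ℤ → List ℕ → Set
IsQuotientPart s n q = IsPartition q × (∀ m → + part q m ≡ n + + suc m - s m)

-- On the t-abacus the BG-rank is a signed bead count: for λ with at most L rows and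
-- β-numbers β_i = λ_{i+1} − (i+1), 2·BG(λ) = Σ_{u<L} (−1)^u + Σ_{i<L} (−1)^{β_i}.
-- Removing a t-rim hook leaves a border strip, which moves a single bead from x to x − t,
-- so the number of beads on each runner never changes.  In a t-core every bead x with
-- x − t in range has a bead at x − t (otherwise a rim hook ending at x − t could be
-- removed), so each runner of the core is filled from the bottom.  On runner k the empty
-- places of π are the levels s_m − 1 (m < M); comparing π with its core runner by runner
-- leaves Σ_{m<M} ((−1)^{t(n_k+m)+k} − (−1)^{t(s_m−1)+k}), which for odd t is
-- (−1)^{k+n_k}·2·BG(π̂_k).

module Submission where

open import Defs
open import Data.Nat as ℕ using (ℕ; zero; suc; z≤n; s≤s)
import Data.Nat.Properties as ℕ
open import Data.Integer as ℤ using (ℤ; +_; -[1+_]; -_; _+_; _-_; _*_; ∣_∣)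
import Data.Integer.Properties as ℤ
open import Data.Integer.Solver using (module +-*-Solver)
open import Data.Fin using (Fin; toℕ) renaming (zero to fzero; suc to fsuc)
import Data.Fin.Properties as Fin
open import Data.List using (List; []; _∷_; length)
open import Data.Product using (∃; ∃₂; _×_; _,_; proj₁; proj₂)
open import Data.Sum using (_⊎_; inj₁; inj₂)
open import Data.Empty using (⊥-elim)
open import Function using (_∘_)
open import Relation.Binary.PropositionalEquality
open import Relation.Binary.Definitions using (tri<; tri≈; tri>)
open import Relation.Binary.Construct.Closure.ReflexiveTransitive using (Star; ε; _◅_; _◅◅_; reverse)
open import Relation.Nullary using (¬_; yes; no)
open import Relation.Unary using (Decidable)
open import Algebra.Properties.AbelianGroup ℤ.+-0-abelianGroup using () renaming (∙-cancelˡ to +-cancelˡ; ∙-cancelʳ to +-cancelʳ)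
open +-*-Solver

-- Opaque: the witness is never computed with, and unfolding it slows conversion checks badly.
opaque
  ≤⇒≡+ : ∀ {i j : ℤ} → i ℤ.≤ j → ∃ λ n → j ≡ i + + n
  ≤⇒≡+ {i} {j} i≤j with j - i in eq | ℤ.i≤j⇒0≤j-i i≤j
  ... | + n | _ = n , trans (solve 2 (λ a b → b := a :+ (b :- a)) refl i j) (cong (_+_ i) eq)

<⇒≡+suc : ∀ {i j : ℤ} → i ℤ.< j → ∃ λ n → j ≡ i + + suc n
<⇒≡+suc {i} i<j with ≤⇒≡+ (ℤ.i<j⇒suc[i]≤j i<j)
... | n , eq = n , trans eq (solve 2 (λ a b → (con (+ 1) :+ a) :+ b := a :+ (con (+ 1) :+ b)) refl i (+ n))

≡+⇒≤ : ∀ {i j : ℤ} n → j ≡ i + + n → i ℤ.≤ j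
≡+⇒≤ {i} n refl = ℤ.i≤i+j i (+ n)

≡+suc⇒< : ∀ {i j : ℤ} n → j ≡ i + + suc n → i ℤ.< j
≡+suc⇒< {i} n refl = ℤ.suc[i]≤j⇒i<j (≡+⇒≤ n (solve 2 (λ a b → a :+ (con (+ 1) :+ b) := (con (+ 1) :+ a) :+ b) refl i (+ n)))

<⇒≤-1 : ∀ {i j : ℤ} → i ℤ.< j → i ℤ.≤ j - + 1
<⇒≤-1 {i} {j} i<j = subst (i ℤ.≤_) (ℤ.+-comm (- + 1) j) (ℤ.i<j⇒i≤pred[j] i<j)

δ : ℤ → ℤ → ℤ
δ x y with x ℤ.≟ y
... | yes _ = + 1
... | no  _ = + 0

δ-refl : ∀ x → δ x x ≡ + 1
δ-refl x with x ℤ.≟ x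
... | yes _  = refl
... | no x≢x = ⊥-elim (x≢x refl)

δ-≢ : ∀ {x y} → x ≢ y → δ x y ≡ + 0
δ-≢ {x} {y} x≢y with x ℤ.≟ y
... | yes x≡y = ⊥-elim (x≢y x≡y)
... | no  _   = refl

δ-sym : ∀ x y → δ x y ≡ δ y x
δ-sym x y with x ℤ.≟ y
... | yes refl = sym (δ-refl x)
... | no  x≢y  = sym (δ-≢ (x≢y ∘ sym))

+-cancelʳ-≤ : ∀ (x : ℤ) {a b} → a + x ℤ.≤ b + x → a ℤ.≤ b
+-cancelʳ-≤ x {a} {b} a+x≤b+x =
  subst₂ ℤ._≤_ (solve 2 (λ a x → a :+ x :- x := a) refl a x) (solve 2 (λ b x → b :+ x :- x := b) refl b x)
         (ℤ.+-monoˡ-≤ (- x) a+x≤b+x)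

δ-+ : ∀ x y c → δ (x + c) (y + c) ≡ δ x y
δ-+ x y c with x ℤ.≟ y
... | yes refl = δ-refl (x + c)
... | no  x≢y  = δ-≢ (x≢y ∘ +-cancelʳ c x y)

module _ {P : ℕ → Set} (P? : Decidable P) where

  least : ∀ {n} → (∃ λ i → i ℕ.< n × P i) → ∃ λ a → a ℕ.< n × P a × (∀ i → i ℕ.< a → ¬ P i)
  least {suc n} (i , i<1+n , Pi) with ℕ.anyUpTo? P? n
  ... | yes below = let a , a<n , Pa , min = least below in a , ℕ.m≤n⇒m≤1+n a<n , Pa , min
  ... | no  none  = i , i<1+n , Pi , λ j j<i Pj → none (j , ℕ.<-≤-trans j<i (ℕ.≤-pred i<1+n) , Pj)

  greatest : ∀ {n} → (∃ λ i → i ℕ.< n × P i) → ∃ λ b → b ℕ.< n × P b × (∀ i → b ℕ.< i → i ℕ.< n → ¬ P i)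
  greatest {suc n} (i , i<1+n , Pi) with P? n
  ... | yes Pn  = n , ℕ.≤-refl , Pn , λ j n<j j<1+n _ → ℕ.<-irrefl refl (ℕ.<-≤-trans n<j (ℕ.≤-pred j<1+n))
  ... | no  ¬Pn with greatest (i , ℕ.≤∧≢⇒< (ℕ.≤-pred i<1+n) (λ i≡n → ¬Pn (subst P i≡n Pi)) , Pi)
  ...   | b , b<n , Pb , max = b , ℕ.m≤n⇒m≤1+n b<n , Pb , above
    where
    above : ∀ j → b ℕ.< j → j ℕ.< suc n → ¬ P j
    above j b<j j<1+n with j ℕ.≟ n
    ... | yes refl = ¬Pn
    ... | no  j≢n  = max j b<j (ℕ.≤∧≢⇒< (ℕ.≤-pred j<1+n) j≢n)

-- Finite sums

∑< : ℕ → (ℕ → ℤ) → ℤ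
∑< zero    f = + 0
∑< (suc n) f = ∑< n f + f n

infixl 10 ∑<
syntax ∑< n (λ i → e) = ∑[ i < n ] e

∑<-cong : ∀ n {f g : ℕ → ℤ} → (∀ i → i ℕ.< n → f i ≡ g i) → ∑< n f ≡ ∑< n g
∑<-cong zero    f≗g = refl
∑<-cong (suc n) f≗g = cong₂ _+_ (∑<-cong n (λ i i<n → f≗g i (ℕ.m≤n⇒m≤1+n i<n))) (f≗g n ℕ.≤-refl)

∑<-zero : ∀ n {f : ℕ → ℤ} → (∀ i → i ℕ.< n → f i ≡ + 0) → ∑< n f ≡ + 0
∑<-zero zero    f≗0 = refl
∑<-zero (suc n) f≗0 = cong₂ _+_ (∑<-zero n (λ i i<n → f≗0 i (ℕ.m≤n⇒m≤1+n i<n))) (f≗0 n ℕ.≤-refl)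

∑<-one : ∀ n → ∑[ i < n ] (+ 1) ≡ + n
∑<-one zero    = refl
∑<-one (suc n) = trans (cong (_+ + 1) (∑<-one n)) (cong +_ (ℕ.+-comm n 1))

∑<-+ : ∀ n (f g : ℕ → ℤ) → ∑[ i < n ] (f i + g i) ≡ ∑< n f + ∑< n g
∑<-+ zero    f g = refl
∑<-+ (suc n) f g rewrite ∑<-+ n f g =
  solve 4 (λ a b c d → (a :+ b) :+ (c :+ d) := (a :+ c) :+ (b :+ d)) refl (∑< n f) (∑< n g) (f n) (g n)

∑<-neg : ∀ n (f : ℕ → ℤ) → ∑[ i < n ] (- f i) ≡ - ∑< n f
∑<-neg zero    f = refl
∑<-neg (suc n) f rewrite ∑<-neg n f = sym (ℤ.neg-distrib-+ (∑< n f) (f n))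

∑<-- : ∀ n (f g : ℕ → ℤ) → ∑[ i < n ] (f i - g i) ≡ ∑< n f - ∑< n g
∑<-- n f g = trans (∑<-+ n f (λ i → - g i)) (cong (λ s → ∑< n f + s) (∑<-neg n g))

∑<-*ˡ : ∀ n c (f : ℕ → ℤ) → ∑[ i < n ] (c * f i) ≡ c * ∑< n f
∑<-*ˡ zero    c f = sym (ℤ.*-zeroʳ c)
∑<-*ˡ (suc n) c f rewrite ∑<-*ˡ n c f = sym (ℤ.*-distribˡ-+ c (∑< n f) (f n))

∑<-*ʳ : ∀ n (f : ℕ → ℤ) c → ∑[ i < n ] (f i * c) ≡ ∑< n f * c
∑<-*ʳ n f c = begin
  ∑[ i < n ] (f i * c)  ≡⟨ ∑<-cong n (λ i _ → ℤ.*-comm (f i) c) ⟩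
  ∑[ i < n ] (c * f i)  ≡⟨ ∑<-*ˡ n c f ⟩
  c * ∑< n f            ≡⟨ ℤ.*-comm c (∑< n f) ⟩
  ∑< n f * c            ∎
  where open ≡-Reasoning

∑<-split : ∀ m n (f : ℕ → ℤ) → ∑< (m ℕ.+ n) f ≡ ∑< m f + (∑[ i < n ] f (m ℕ.+ i))
∑<-split m zero    f rewrite ℕ.+-identityʳ m = sym (ℤ.+-identityʳ (∑< m f))
∑<-split m (suc n) f rewrite ℕ.+-suc m n | ∑<-split m n f =
  ℤ.+-assoc (∑< m f) (∑[ i < n ] f (m ℕ.+ i)) (f (m ℕ.+ n))

∑<-head : ∀ n (f : ℕ → ℤ) → ∑< (suc n) f ≡ f 0 + (∑[ i < n ] f (suc i))
∑<-head n f = trans (∑<-split 1 n f) (cong (_+ (∑[ i < n ] f (suc i))) (ℤ.+-identityˡ (f 0)))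

∑<-swap : ∀ m n (F : ℕ → ℕ → ℤ) → ∑[ i < m ] ∑[ j < n ] F i j ≡ ∑[ j < n ] ∑[ i < m ] F i j
∑<-swap zero    n F = sym (∑<-zero n (λ _ _ → refl))
∑<-swap (suc m) n F rewrite ∑<-swap m n F = sym (∑<-+ n (λ j → ∑[ i < m ] F i j) (λ j → F m j))

∑<-blocks : ∀ t D (f : ℕ → ℤ) → ∑< (D ℕ.* t) f ≡ ∑[ u < D ] ∑[ j < t ] f (u ℕ.* t ℕ.+ j)
∑<-blocks t zero    f = refl
∑<-blocks t (suc D) f rewrite ℕ.+-comm t (D ℕ.* t) | ∑<-split (D ℕ.* t) t f | ∑<-blocks t D f = refl

sumFin-cong : ∀ t {f g : Fin t → ℤ} → (∀ j → f j ≡ g j) → sumFin t f ≡ sumFin t g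
sumFin-cong zero    f≗g = refl
sumFin-cong (suc t) f≗g = cong₂ _+_ (f≗g fzero) (sumFin-cong t (λ j → f≗g (fsuc j)))

sumFin-+ : ∀ t (f g : Fin t → ℤ) → sumFin t (λ j → f j + g j) ≡ sumFin t f + sumFin t g
sumFin-+ zero    f g = refl
sumFin-+ (suc t) f g rewrite sumFin-+ t (λ j → f (fsuc j)) (λ j → g (fsuc j)) =
  solve 4 (λ a b c d → (a :+ b) :+ (c :+ d) := (a :+ c) :+ (b :+ d)) refl
    (f fzero) (g fzero) (sumFin t (λ j → f (fsuc j))) (sumFin t (λ j → g (fsuc j)))

sumFin-*ˡ : ∀ t c (f : Fin t → ℤ) → sumFin t (λ j → c * f j) ≡ c * sumFin t f
sumFin-*ˡ zero    c f = sym (ℤ.*-zeroʳ c)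
sumFin-*ˡ (suc t) c f rewrite sumFin-*ˡ t c (λ j → f (fsuc j)) =
  sym (ℤ.*-distribˡ-+ c (f fzero) (sumFin t (λ j → f (fsuc j))))

sumFin-toℕ : ∀ t (f : ℕ → ℤ) → sumFin t (λ j → f (toℕ j)) ≡ ∑< t f
sumFin-toℕ zero    f = refl
sumFin-toℕ (suc t) f = trans (cong (λ s → f 0 + s) (sumFin-toℕ t (λ i → f (suc i)))) (sym (∑<-head t f))

sumFin-∑< : ∀ t n (F : Fin t → ℕ → ℤ) → sumFin t (λ j → ∑< n (F j)) ≡ ∑[ u < n ] sumFin t (λ j → F j u)
sumFin-∑< zero    n F = sym (∑<-zero n (λ _ _ → refl))
sumFin-∑< (suc t) n F rewrite sumFin-∑< t n (λ j → F (fsuc j)) =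
  sym (∑<-+ n (F fzero) (λ u → sumFin t (λ j → F (fsuc j) u)))

negOnePowℕ-square : ∀ n → negOnePowℕ n * negOnePowℕ n ≡ + 1
negOnePowℕ-square zero    = refl
negOnePowℕ-square (suc n) = trans (solve 1 (λ a → (:- a) :* (:- a) := a :* a) refl (negOnePowℕ n)) (negOnePowℕ-square n)

negOnePowℕ-parity : ∀ p → + 1 - negOnePowℕ p ≡ + 2 * + (p ℕ.% 2)
negOnePowℕ-parity zero          = refl
negOnePowℕ-parity (suc zero)    = refl
negOnePowℕ-parity (suc (suc p)) rewrite ℤ.neg-involutive (negOnePowℕ p) = negOnePowℕ-parity p

negOnePow-square : ∀ x → negOnePow x * negOnePow x ≡ + 1
negOnePow-square x = negOnePowℕ-square ∣ x ∣

negOnePow-neg : ∀ x → negOnePow (- x) ≡ negOnePow x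
negOnePow-neg x = cong negOnePowℕ (ℤ.∣-i∣≡∣i∣ x)

negOnePow-suc : ∀ x → negOnePow (x + + 1) ≡ - negOnePow x
negOnePow-suc (+ m)            = cong negOnePowℕ (ℕ.+-comm m 1)
negOnePow-suc -[1+ zero ]      = refl
negOnePow-suc -[1+ suc m ]     = sym (ℤ.neg-involutive _)

negOnePow-+ℕ : ∀ n x → negOnePow (x + + n) ≡ negOnePow x * negOnePowℕ n
negOnePow-+ℕ zero    x = trans (cong negOnePow (ℤ.+-identityʳ x)) (sym (ℤ.*-identityʳ (negOnePow x)))
negOnePow-+ℕ (suc n) x = begin
  negOnePow (x + + suc n)          ≡⟨ cong negOnePow (solve 2 (λ a b → a :+ (con (+ 1) :+ b) := (a :+ b) :+ con (+ 1)) refl x (+ n)) ⟩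
  negOnePow (x + + n + + 1)        ≡⟨ negOnePow-suc (x + + n) ⟩
  - negOnePow (x + + n)            ≡⟨ cong -_ (negOnePow-+ℕ n x) ⟩
  - (negOnePow x * negOnePowℕ n)   ≡⟨ ℤ.neg-distribʳ-* (negOnePow x) (negOnePowℕ n) ⟩
  negOnePow x * - negOnePowℕ n     ∎
  where open ≡-Reasoning

negOnePow-+ : ∀ x y → negOnePow (x + y) ≡ negOnePow x * negOnePow y
negOnePow-+ x (+ n)     = negOnePow-+ℕ n x
negOnePow-+ x -[1+ n ]  = sym (begin
  negOnePow x * ω                ≡⟨ cong (λ w → negOnePow w * ω) (solve 2 (λ a b → a := (a :- b) :+ b) refl x (+ suc n)) ⟩
  negOnePow (z + + suc n) * ω    ≡⟨ cong (_* ω) (negOnePow-+ℕ (suc n) z) ⟩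
  negOnePow z * ω * ω            ≡⟨ ℤ.*-assoc (negOnePow z) ω ω ⟩
  negOnePow z * (ω * ω)          ≡⟨ cong (negOnePow z *_) (negOnePowℕ-square (suc n)) ⟩
  negOnePow z * + 1              ≡⟨ ℤ.*-identityʳ (negOnePow z) ⟩
  negOnePow z                    ∎)
  where
  open ≡-Reasoning
  z = x + -[1+ n ]
  ω = negOnePowℕ (suc n)

negOnePow-odd-* : ∀ t → Odd t → ∀ y → negOnePow (+ t * y) ≡ negOnePow y
negOnePow-odd-* (suc zero)    _   y = cong negOnePow (ℤ.*-identityˡ y)
negOnePow-odd-* (suc (suc t)) odd y = begin
  negOnePow (+ suc (suc t) * y)              ≡⟨ cong negOnePow (solve 2 (λ a b → (con (+ 2) :+ a) :* b := (b :+ b) :+ a :* b) refl (+ t) y) ⟩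
  negOnePow ((y + y) + + t * y)              ≡⟨ negOnePow-+ (y + y) (+ t * y) ⟩
  negOnePow (y + y) * negOnePow (+ t * y)    ≡⟨ cong₂ _*_ (trans (negOnePow-+ y y) (negOnePow-square y)) (negOnePow-odd-* t odd y) ⟩
  + 1 * negOnePow y                          ≡⟨ ℤ.*-identityˡ (negOnePow y) ⟩
  negOnePow y                                ∎
  where open ≡-Reasoning

∑<-rotate : ∀ {a b} L (f g : ℕ → ℤ) → a ℕ.≤ b → b ℕ.< L →
  (∀ i → i ℕ.< a → g i ≡ f i) → (∀ i → a ℕ.≤ i → i ℕ.< b → g i ≡ f (suc i)) → (∀ i → b ℕ.< i → g i ≡ f i) →
  ∑< L g + f a ≡ ∑< L f + g b
∑<-rotate {a} {b} L f g a≤b b<L g-before g-along g-after with ℕ.m≤n⇒∃[o]m+o≡n b<L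
... | e , refl = suffix e
  where
  middle : ∀ k → a ℕ.+ k ℕ.≤ b → ∑< (a ℕ.+ k) g + f a ≡ ∑< (a ℕ.+ k) f + f (a ℕ.+ k)
  middle zero    _   rewrite ℕ.+-identityʳ a = cong (_+ f a) (∑<-cong a (λ i i<a → g-before i i<a))
  middle (suc k) a+k<b rewrite ℕ.+-suc a k = begin
    ∑< (a ℕ.+ k) g + g (a ℕ.+ k) + f a           ≡⟨ solve 3 (λ x y z → x :+ y :+ z := (x :+ z) :+ y) refl (∑< (a ℕ.+ k) g) (g (a ℕ.+ k)) (f a) ⟩
    ∑< (a ℕ.+ k) g + f a + g (a ℕ.+ k)           ≡⟨ cong₂ _+_ (middle k (ℕ.<⇒≤ a+k<b)) (g-along (a ℕ.+ k) (ℕ.m≤m+n a k) a+k<b) ⟩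
    ∑< (a ℕ.+ k) f + f (a ℕ.+ k) + f (suc (a ℕ.+ k)) ∎
    where open ≡-Reasoning
  upToLast : ∑< b g + f a ≡ ∑< b f + f b
  upToLast with ℕ.m≤n⇒∃[o]m+o≡n a≤b
  ... | d , refl = middle d ℕ.≤-refl
  suffix : ∀ k → ∑< (suc b ℕ.+ k) g + f a ≡ ∑< (suc b ℕ.+ k) f + g b
  suffix zero rewrite ℕ.+-identityʳ b = begin
    ∑< b g + g b + f a      ≡⟨ solve 3 (λ x y z → x :+ y :+ z := (x :+ z) :+ y) refl (∑< b g) (g b) (f a) ⟩
    ∑< b g + f a + g b      ≡⟨ cong (_+ g b) upToLast ⟩
    ∑< b f + f b + g b      ∎
    where open ≡-Reasoning
  suffix (suc k) rewrite ℕ.+-suc b k = begin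
    ∑< (suc b ℕ.+ k) g + g x + f a   ≡⟨ solve 3 (λ s y z → s :+ y :+ z := (s :+ z) :+ y) refl (∑< (suc b ℕ.+ k) g) (g x) (f a) ⟩
    ∑< (suc b ℕ.+ k) g + f a + g x   ≡⟨ cong₂ _+_ (suffix k) (g-after x (s≤s (ℕ.m≤m+n b k))) ⟩
    ∑< (suc b ℕ.+ k) f + g b + f x   ≡⟨ solve 3 (λ s y z → s :+ y :+ z := (s :+ z) :+ y) refl (∑< (suc b ℕ.+ k) f) (g b) (f x) ⟩
    ∑< (suc b ℕ.+ k) f + f x + g b   ∎
    where
    open ≡-Reasoning
    x = suc (b ℕ.+ k)

module _ (D : ℕ) (g : ℕ → ℤ) (bit : ∀ u → u ℕ.< D → g u ≡ + 0 ⊎ g u ≡ + 1)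
         (downward : ∀ u → suc u ℕ.< D → g (suc u) ≡ + 1 → g u ≡ + 1) where

  ones-below : ∀ {u v} → v ℕ.≤ u → u ℕ.< D → g u ≡ + 1 → g v ≡ + 1
  ones-below {u} {v} v≤u u<D gu≡1 with v ℕ.≟ u
  ... | yes refl = gu≡1
  ones-below {zero}  z≤n _ _ | no 0≢0 = ⊥-elim (0≢0 refl)
  ones-below {suc u} {v} v≤1+u 1+u<D g≡1 | no v≢1+u =
    ones-below (ℕ.≤-pred (ℕ.≤∧≢⇒< v≤1+u v≢1+u)) (ℕ.<-trans ℕ.≤-refl 1+u<D) (downward u 1+u<D g≡1)

  prefix-of-ones : ∀ d → d ℕ.≤ D →
    ∃ λ e → e ℕ.≤ d × (∀ u → u ℕ.< e → g u ≡ + 1) × (∀ u → e ℕ.≤ u → u ℕ.< d → g u ≡ + 0)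
  prefix-of-ones zero    _     = 0 , z≤n , (λ _ ()) , (λ _ _ ())
  prefix-of-ones (suc d) 1+d≤D with prefix-of-ones d (ℕ.<⇒≤ 1+d≤D) | bit d 1+d≤D
  ... | e , e≤d , ones , zeros | inj₁ gd≡0 = e , ℕ.m≤n⇒m≤1+n e≤d , ones , zeros′
    where
    zeros′ : ∀ u → e ℕ.≤ u → u ℕ.< suc d → g u ≡ + 0
    zeros′ u e≤u u<1+d with u ℕ.≟ d
    ... | yes refl = gd≡0
    ... | no  u≢d  = zeros u e≤u (ℕ.≤∧≢⇒< (ℕ.≤-pred u<1+d) u≢d)
  ... | e , e≤d , ones , zeros | inj₂ gd≡1 = suc d , ℕ.≤-refl , ones′ , λ u 1+d≤u u<1+d → ⊥-elim (ℕ.<⇒≱ u<1+d 1+d≤u)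
    where
    ones′ : ∀ u → u ℕ.< suc d → g u ≡ + 1
    ones′ u u<1+d = ones-below (ℕ.≤-pred u<1+d) 1+d≤D gd≡1

  ∑<-prefix : ∀ e (f : ℕ → ℤ) → e ℕ.≤ D → (∀ u → u ℕ.< e → g u ≡ + 1) → (∀ u → e ℕ.≤ u → u ℕ.< D → g u ≡ + 0) →
    ∑[ u < D ] (g u * f u) ≡ ∑< e f
  ∑<-prefix e f e≤D ones zeros with ℕ.m≤n⇒∃[o]m+o≡n e≤D
  ... | d , refl = begin
    ∑[ u < e ℕ.+ d ] (g u * f u)                              ≡⟨ ∑<-split e d (λ u → g u * f u) ⟩
    ∑[ u < e ] (g u * f u) + ∑[ u < d ] (g (e ℕ.+ u) * f (e ℕ.+ u))
      ≡⟨ cong₂ _+_ (∑<-cong e (λ u u<e → trans (cong (_* f u) (ones u u<e)) (ℤ.*-identityˡ (f u))))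
                   (∑<-zero d (λ u u<d → trans (cong (_* f (e ℕ.+ u)) (zeros (e ℕ.+ u) (ℕ.m≤m+n e u) (ℕ.+-monoʳ-< e u<d)))
                                               (ℤ.*-zeroˡ (f (e ℕ.+ u))))) ⟩
    ∑< e f + + 0                                              ≡⟨ ℤ.+-identityʳ (∑< e f) ⟩
    ∑< e f                                                    ∎
    where open ≡-Reasoning

  ∑<-downward-closed : ∃ λ e → ∀ f → ∑[ u < D ] (g u * f u) ≡ ∑< e f
  ∑<-downward-closed with prefix-of-ones D ℕ.≤-refl
  ... | e , e≤D , ones , zeros = e , λ f → ∑<-prefix e f e≤D ones zeros

multiplicity : ℕ → (ℕ → ℤ) → ℤ → ℤ
multiplicity N f x = ∑[ i < N ] δ x (f i)

δ-*-subst : ∀ x y (h : ℤ → ℤ) → δ x y * h y ≡ δ x y * h x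
δ-*-subst x y h with x ℤ.≟ y
... | yes refl = refl
... | no  _    = refl

multiplicity-absent : ∀ n (f : ℕ → ℤ) x → (∀ i → i ℕ.< n → f i ≢ x) → multiplicity n f x ≡ + 0
multiplicity-absent n f x f≢x = ∑<-zero n (λ i i<n → δ-≢ (f≢x i i<n ∘ sym))

multiplicity-unique : ∀ n (f : ℕ → ℤ) x i₀ → i₀ ℕ.< n → f i₀ ≡ x → (∀ i → i ℕ.< n → f i ≡ x → i ≡ i₀) →
                      multiplicity n f x ≡ + 1
multiplicity-unique zero    f x i₀ () _ _
multiplicity-unique (suc n) f x i₀ i₀<1+n fi₀≡x unique with i₀ ℕ.≟ n
... | yes refl = begin
  ∑[ i < n ] δ x (f i) + δ x (f i₀)   ≡⟨ cong₂ _+_ (multiplicity-absent n f x below) (trans (cong (δ x) fi₀≡x) (δ-refl x)) ⟩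
  + 1                                 ∎
  where
  open ≡-Reasoning
  below : ∀ i → i ℕ.< n → f i ≢ x
  below i i<n fi≡x = ℕ.<-irrefl (unique i (ℕ.m≤n⇒m≤1+n i<n) fi≡x) i<n
... | no i₀≢n = begin
  ∑[ i < n ] δ x (f i) + δ x (f n)   ≡⟨ cong₂ _+_ earlier (δ-≢ (λ x≡fn → i₀≢n (sym (unique n ℕ.≤-refl (sym x≡fn))))) ⟩
  + 1 + + 0                          ∎
  where
  open ≡-Reasoning
  earlier = multiplicity-unique n f x i₀ (ℕ.≤∧≢⇒< (ℕ.≤-pred i₀<1+n) i₀≢n) fi₀≡x (λ i i<n → unique i (ℕ.m≤n⇒m≤1+n i<n))

InWindow : ℤ → ℕ → ℤ → Set
InWindow lo W x = lo ℤ.≤ x × x ℤ.< lo + + W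

InWindow⇒offset : ∀ {lo W x} → InWindow lo W x → ∃ λ u → u ℕ.< W × x ≡ lo + + u
InWindow⇒offset {lo} {W} (lo≤x , x<lo+W) with ≤⇒≡+ lo≤x
... | u , refl with <⇒≡+suc x<lo+W
...   | d , eq = u , subst (u ℕ.<_) (sym W≡u+1+d) (ℕ.m<m+n u (s≤s z≤n)) , refl
  where
  W≡u+1+d : W ≡ u ℕ.+ suc d
  W≡u+1+d = ℤ.+-injective (+-cancelˡ lo (+ W) (+ (u ℕ.+ suc d)) (trans eq (trans (ℤ.+-assoc lo (+ u) (+ suc d)) (cong (_+_ lo) (sym (ℤ.pos-+ u (suc d)))))))

∑<-by-multiplicity : ∀ N (f : ℕ → ℤ) (h : ℤ → ℤ) lo W → (∀ i → i ℕ.< N → InWindow lo W (f i)) →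
  ∑[ i < N ] h (f i) ≡ ∑[ u < W ] (multiplicity N f (lo + + u) * h (lo + + u))
∑<-by-multiplicity N f h lo W inWindow = begin
  ∑[ i < N ] h (f i)                                            ≡⟨ ∑<-cong N (λ i i<N → sym (select i i<N)) ⟩
  ∑[ i < N ] ∑[ u < W ] (δ (f i) (lo + + u) * h (lo + + u))      ≡⟨ ∑<-swap N W _ ⟩
  ∑[ u < W ] ∑[ i < N ] (δ (f i) (lo + + u) * h (lo + + u))      ≡⟨ ∑<-cong W (λ u _ → regroup u) ⟩
  ∑[ u < W ] (multiplicity N f (lo + + u) * h (lo + + u))        ∎
  where
  open ≡-Reasoning
  select : ∀ i → i ℕ.< N → ∑[ u < W ] (δ (f i) (lo + + u) * h (lo + + u)) ≡ h (f i)
  select i i<N with InWindow⇒offset (inWindow i i<N)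
  ... | u₀ , u₀<W , fi≡ = begin
    ∑[ u < W ] (δ (f i) (lo + + u) * h (lo + + u))  ≡⟨ ∑<-cong W (λ u _ → δ-*-subst (f i) (lo + + u) h) ⟩
    ∑[ u < W ] (δ (f i) (lo + + u) * h (f i))       ≡⟨ ∑<-*ʳ W (λ u → δ (f i) (lo + + u)) (h (f i)) ⟩
    ∑[ u < W ] δ (f i) (lo + + u) * h (f i)         ≡⟨ cong (_* h (f i)) (multiplicity-unique W (λ u → lo + + u) (f i) u₀ u₀<W (sym fi≡)
                                                        (λ u _ eq → ℤ.+-injective (+-cancelˡ lo (+ u) (+ u₀) (trans eq fi≡)))) ⟩
    + 1 * h (f i)                                   ≡⟨ ℤ.*-identityˡ (h (f i)) ⟩
    h (f i)                                         ∎
  regroup : ∀ u → ∑[ i < N ] (δ (f i) (lo + + u) * h (lo + + u)) ≡ multiplicity N f (lo + + u) * h (lo + + u)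
  regroup u = trans (∑<-cong N (λ i _ → cong (_* h (lo + + u)) (δ-sym (f i) (lo + + u))))
                    (∑<-*ʳ N (λ i → δ (lo + + u) (f i)) (h (lo + + u)))

-- Partitions and β-numbers

AtMostRows : ℕ → List ℕ → Set
AtMostRows L la = ∀ i → L ℕ.≤ i → part la i ≡ 0

AtMostRows-length : ∀ la → AtMostRows (length la) la
AtMostRows-length []       i       _         = refl
AtMostRows-length (x ∷ la) (suc i) (s≤s n≤i) = AtMostRows-length la i n≤i

part-suc≤ : ∀ {la} → IsPartition la → ∀ i → part la (suc i) ℕ.≤ part la i
part-suc≤ nil          i       = z≤n
part-suc≤ (one _)      i       = z≤n
part-suc≤ (cons y≤x _) zero    = y≤x
part-suc≤ (cons _ p)   (suc i) = part-suc≤ p i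

Nonincreasing : (ℕ → ℕ) → Set
Nonincreasing g = ∀ i → g (suc i) ℕ.≤ g i

nonincreasing-anti : ∀ {g} → Nonincreasing g → ∀ {i j} → i ℕ.≤ j → g j ℕ.≤ g i
nonincreasing-anti {g} dec {i} i≤j with ℕ.m≤n⇒∃[o]m+o≡n i≤j
... | d , refl = go d
  where
  go : ∀ d → g (i ℕ.+ d) ℕ.≤ g i
  go zero    rewrite ℕ.+-identityʳ i = ℕ.≤-refl
  go (suc d) rewrite ℕ.+-suc i d     = ℕ.≤-trans (dec (i ℕ.+ d)) (go d)

part-anti : ∀ {la} → IsPartition la → ∀ {i j} → i ℕ.≤ j → part la j ℕ.≤ part la i
part-anti p = nonincreasing-anti (part-suc≤ p)

-- Rows are 0-indexed, so β la i is the β-number λ_{i+1} − (i+1) and InBeta la x says x ∈ B.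
β : List ℕ → ℕ → ℤ
β la i = + part la i - + suc i

β-suc< : ∀ {la} → IsPartition la → ∀ i → β la (suc i) ℤ.< β la i
β-suc< {la} p i = ≡+suc⇒< (part la i ℕ.∸ part la (suc i)) (begin
  + a - + suc i                         ≡⟨ cong (λ x → + x - + suc i) (sym (ℕ.m+[n∸m]≡n (part-suc≤ p i))) ⟩
  + (b ℕ.+ (a ℕ.∸ b)) - + suc i         ≡⟨ cong (_- + suc i) (ℤ.pos-+ b (a ℕ.∸ b)) ⟩
  + b + + (a ℕ.∸ b) - + suc i
    ≡⟨ solve 3 (λ x d j → x :+ d :- (con (+ 1) :+ j) := (x :- (con (+ 2) :+ j)) :+ (con (+ 1) :+ d)) refl (+ b) (+ (a ℕ.∸ b)) (+ i) ⟩
  β la (suc i) + + suc (a ℕ.∸ b)        ∎)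
  where
  open ≡-Reasoning
  a = part la i
  b = part la (suc i)

β-anti : ∀ {la} → IsPartition la → ∀ {i j} → i ℕ.< j → β la j ℤ.< β la i
β-anti p {i} {suc j} (s≤s i≤j) with i ℕ.≟ j
... | yes refl = β-suc< p i
... | no  i≢j  = ℤ.<-trans (β-suc< p j) (β-anti p (ℕ.≤∧≢⇒< i≤j i≢j))

β-injective : ∀ {la} → IsPartition la → ∀ {i j} → β la i ≡ β la j → i ≡ j
β-injective p {i} {j} eq with ℕ.<-cmp i j
... | tri< i<j _ _ = ⊥-elim (ℤ.<-irrefl (sym eq) (β-anti p i<j))
... | tri≈ _ i≡j _ = i≡j
... | tri> _ _ j<i = ⊥-elim (ℤ.<-irrefl eq (β-anti p j<i))

twice-bgFrom : ∀ L i xs → AtMostRows L xs →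
  + 2 * bgFrom i xs ≡ ∑[ u < L ] (negOnePowℕ (i ℕ.+ u) * (+ 1 - negOnePowℕ (part xs u)))
twice-bgFrom zero i [] _ = refl
twice-bgFrom zero i (x ∷ xs) rows rewrite rows 0 z≤n = begin
  + 2 * (negOnePowℕ i * + 0 + bgFrom (suc i) xs)   ≡⟨ cong (λ z → + 2 * (z + bgFrom (suc i) xs)) (ℤ.*-zeroʳ (negOnePowℕ i)) ⟩
  + 2 * (+ 0 + bgFrom (suc i) xs)                  ≡⟨ cong (+ 2 *_) (ℤ.+-identityˡ (bgFrom (suc i) xs)) ⟩
  + 2 * bgFrom (suc i) xs                          ≡⟨ twice-bgFrom zero (suc i) xs (λ j _ → rows (suc j) z≤n) ⟩
  + 0                                              ∎
  where open ≡-Reasoning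
twice-bgFrom (suc L) i [] _ = sym (∑<-zero (suc L) (λ u _ → ℤ.*-zeroʳ (negOnePowℕ (i ℕ.+ u))))
twice-bgFrom (suc L) i (x ∷ xs) rows = begin
  + 2 * (negOnePowℕ i * + (x ℕ.% 2) + bgFrom (suc i) xs)
    ≡⟨ ℤ.*-distribˡ-+ (+ 2) (negOnePowℕ i * + (x ℕ.% 2)) (bgFrom (suc i) xs) ⟩
  + 2 * (negOnePowℕ i * + (x ℕ.% 2)) + + 2 * bgFrom (suc i) xs
    ≡⟨ cong₂ _+_ head (twice-bgFrom L (suc i) xs (λ j L≤j → rows (suc j) (s≤s L≤j))) ⟩
  term 0 + ∑[ u < L ] (negOnePowℕ (suc i ℕ.+ u) * (+ 1 - negOnePowℕ (part xs u)))
    ≡⟨ cong (_+_ (term 0)) (∑<-cong L (λ u _ → cong (λ k → negOnePowℕ k * (+ 1 - negOnePowℕ (part xs u))) (sym (ℕ.+-suc i u)))) ⟩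
  term 0 + ∑[ u < L ] term (suc u)
    ≡⟨ sym (∑<-head L term) ⟩
  ∑< (suc L) term ∎
  where
  open ≡-Reasoning
  term : ℕ → ℤ
  term u = negOnePowℕ (i ℕ.+ u) * (+ 1 - negOnePowℕ (part (x ∷ xs) u))
  head : + 2 * (negOnePowℕ i * + (x ℕ.% 2)) ≡ term 0
  head = begin
    + 2 * (negOnePowℕ i * + (x ℕ.% 2))   ≡⟨ solve 2 (λ a b → con (+ 2) :* (a :* b) := a :* (con (+ 2) :* b)) refl (negOnePowℕ i) (+ (x ℕ.% 2)) ⟩
    negOnePowℕ i * (+ 2 * + (x ℕ.% 2))   ≡⟨ cong₂ (λ k z → negOnePowℕ k * z) (sym (ℕ.+-identityʳ i)) (sym (negOnePowℕ-parity x)) ⟩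
    term 0                               ∎

twice-BGrank : ∀ L la → AtMostRows L la →
  + 2 * BGrank la ≡ ∑[ u < L ] negOnePowℕ u + ∑[ u < L ] negOnePow (β la u)
twice-BGrank L la rows = begin
  + 2 * BGrank la                                                        ≡⟨ twice-bgFrom L 0 la rows ⟩
  ∑[ u < L ] (negOnePowℕ u * (+ 1 - negOnePowℕ (part la u)))              ≡⟨ ∑<-cong L (λ u _ → split u) ⟩
  ∑[ u < L ] (negOnePowℕ u + negOnePow (β la u))                          ≡⟨ ∑<-+ L negOnePowℕ (λ u → negOnePow (β la u)) ⟩
  ∑[ u < L ] negOnePowℕ u + ∑[ u < L ] negOnePow (β la u)                 ∎
  where
  open ≡-Reasoning
  split : ∀ u → negOnePowℕ u * (+ 1 - negOnePowℕ (part la u)) ≡ negOnePowℕ u + negOnePow (β la u)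
  split u = begin
    negOnePowℕ u * (+ 1 - negOnePowℕ (part la u))
      ≡⟨ solve 2 (λ a b → a :* (con (+ 1) :- b) := a :+ b :* (:- a)) refl (negOnePowℕ u) (negOnePowℕ (part la u)) ⟩
    negOnePowℕ u + negOnePowℕ (part la u) * - negOnePowℕ u
      ≡⟨ cong (_+_ (negOnePowℕ u)) (sym (negOnePow-+ (+ part la u) (- + suc u))) ⟩
    negOnePowℕ u + negOnePow (β la u) ∎

size≡∑part : ∀ L xs → AtMostRows L xs → + size xs ≡ ∑[ u < L ] (+ part xs u)
size≡∑part zero    []       _    = refl
size≡∑part zero    (x ∷ xs) rows rewrite rows 0 z≤n = size≡∑part zero xs (λ j _ → rows (suc j) z≤n)
size≡∑part (suc L) []       _    = sym (∑<-zero (suc L) (λ _ _ → refl))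
size≡∑part (suc L) (x ∷ xs) rows = begin
  + (x ℕ.+ size xs)                  ≡⟨ ℤ.pos-+ x (size xs) ⟩
  + x + + size xs                    ≡⟨ cong (_+_ (+ x)) (size≡∑part L xs (λ j L≤j → rows (suc j) (s≤s L≤j))) ⟩
  + x + ∑[ u < L ] (+ part xs u)       ≡⟨ sym (∑<-head L (λ u → + part (x ∷ xs) u)) ⟩
  ∑[ u < suc L ] (+ part (x ∷ xs) u)   ∎
  where open ≡-Reasoning

∑part≡∑β+∑suc : ∀ L la → ∑[ i < L ] (+ part la i) ≡ ∑[ i < L ] β la i + ∑[ i < L ] (+ suc i)
∑part≡∑β+∑suc L la = trans (∑<-cong L (λ i _ → solve 2 (λ p s → p := (p :- s) :+ s) refl (+ part la i) (+ suc i)))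
                           (∑<-+ L (β la) (λ i → + suc i))

AtMostColumns : ℕ → List ℕ → Set
AtMostColumns C la = ∀ i → part la i ℕ.≤ C

β-≥ : ∀ la {L i} → i ℕ.< L → - + L ℤ.≤ β la i
β-≥ la {L} {i} i<L = ℤ.≤-trans (ℤ.neg-mono-≤ (ℤ.+≤+ i<L)) (ℤ.i≤j+i (- + suc i) (+ part la i))

β-< : ∀ {C} la → AtMostColumns C la → ∀ i → β la i ℤ.< + C
β-< {C} la cols i =
  ℤ.<-≤-trans (≡+suc⇒< i (solve 2 (λ p s → p := (p :- s) :+ s) refl (+ part la i) (+ suc i))) (ℤ.+≤+ (cols i))

β-beyond : ∀ {L} la → AtMostRows L la → ∀ {i} → L ℕ.≤ i → β la i ≡ -[1+ i ]
β-beyond la rows {i} L≤i = cong (λ p → + p - + suc i) (rows i L≤i)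

-[1+]<-⇒≤ : ∀ L m → -[1+ m ] ℤ.< - + L → L ℕ.≤ m
-[1+]<-⇒≤ zero    m _            = z≤n
-[1+]<-⇒≤ (suc l) m (ℤ.-<- l<m)  = l<m

≤⇒-[1+]<- : ∀ L m → L ℕ.≤ m → -[1+ m ] ℤ.< - + L
≤⇒-[1+]<- zero    m _   = ℤ.-<+
≤⇒-[1+]<- (suc l) m l<m = ℤ.-<- l<m

β-beyond-< : ∀ {L} la → AtMostRows L la → ∀ {i} → L ℕ.≤ i → β la i ℤ.< - + L
β-beyond-< {L} la rows {i} L≤i = subst (ℤ._< - + L) (sym (β-beyond la rows L≤i)) (≤⇒-[1+]<- L i L≤i)

InBeta-below : ∀ {L} la → AtMostRows L la → ∀ x → x ℤ.< - + L → InBeta la x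
InBeta-below {L} la rows (+ m)    x<-L = ⊥-elim (ℤ.<⇒≱ x<-L (ℤ.neg-≤-pos {L} {m}))
InBeta-below {L} la rows -[1+ m ] x<-L = m , β-beyond la rows (-[1+]<-⇒≤ L m x<-L)

InBeta⇒index : ∀ {L} la → AtMostRows L la → ∀ {x} → - + L ℤ.≤ x → InBeta la x → ∃ λ i → i ℕ.< L × β la i ≡ x
InBeta⇒index {L} la rows {x} -L≤x (i , βi≡x) with i ℕ.<? L
... | yes i<L = i , i<L , βi≡x
... | no  i≮L = ⊥-elim (ℤ.<⇒≱ (subst (ℤ._< - + L) βi≡x (β-beyond-< la rows (ℕ.≮⇒≥ i≮L))) -L≤x)

-- Border strips

-- λ/μ occupies rows a … b.  As sets of β-numbers, μ arises from λ by moving the bead β λ a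
-- to β μ b, while the β-numbers of rows a+1 … b become those of rows a … b−1 (β-rotate).
record BorderStrip (la mu : List ℕ) (a b : ℕ) : Set where
  field
    a≤b    : a ℕ.≤ b
    before : ∀ i → i ℕ.< a → part mu i ≡ part la i
    along  : ∀ i → a ℕ.≤ i → i ℕ.< b → suc (part mu i) ≡ part la (suc i)
    last   : part mu b ℕ.< part la b
    after  : ∀ i → b ℕ.< i → part mu i ≡ part la i

module BorderStripProperties {la mu a b} (pl : IsPartition la) (pm : IsPartition mu) (strip : BorderStrip la mu a b) where
  open BorderStrip strip

  μ⊆λ : ∀ i → part mu i ℕ.≤ part la i
  μ⊆λ i with i ℕ.<? a | i ℕ.<? b | i ℕ.≟ b
  ... | yes i<a | _       | _       = ℕ.≤-reflexive (before i i<a)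
  ... | no  i≮a | yes i<b | _       = ℕ.≤-trans (ℕ.n≤1+n _) (ℕ.≤-trans (ℕ.≤-reflexive (along i (ℕ.≮⇒≥ i≮a) i<b)) (part-suc≤ pl i))
  ... | no  _   | no  _   | yes refl = ℕ.<⇒≤ last
  ... | no  _   | no  i≮b | no  i≢b = ℕ.≤-reflexive (after i (ℕ.≤∧≢⇒< (ℕ.≮⇒≥ i≮b) (i≢b ∘ sym)))

  rows-within : ∀ {i} → part mu i ℕ.< part la i → a ℕ.≤ i × i ℕ.≤ b
  rows-within {i} μ<λ with i ℕ.<? a | b ℕ.<? i
  ... | yes i<a | _       = ⊥-elim (ℕ.<-irrefl (before i i<a) μ<λ)
  ... | no  _   | yes b<i = ⊥-elim (ℕ.<-irrefl (after i b<i) μ<λ)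
  ... | no  i≮a | no  b≮i = ℕ.≮⇒≥ i≮a , ℕ.≮⇒≥ b≮i

  AtMostRows-mu : ∀ {L} → AtMostRows L la → AtMostRows L mu
  AtMostRows-mu rows i L≤i = ℕ.n≤0⇒n≡0 (subst (part mu i ℕ.≤_) (rows i L≤i) (μ⊆λ i))

  β-along : ∀ i → a ℕ.≤ i → i ℕ.< b → β mu i ≡ β la (suc i)
  β-along i a≤i i<b = begin
    + part mu i - + suc i                 ≡⟨ solve 2 (λ p j → p :- (con (+ 1) :+ j) := (con (+ 1) :+ p) :- (con (+ 2) :+ j)) refl (+ part mu i) (+ i) ⟩
    + suc (part mu i) - + suc (suc i)     ≡⟨ cong (λ p → + p - + suc (suc i)) (along i a≤i i<b) ⟩
    β la (suc i)                          ∎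
    where open ≡-Reasoning

  β-rotate : ∀ {L} (h : ℤ → ℤ) → b ℕ.< L →
    ∑[ i < L ] h (β mu i) + h (β la a) ≡ ∑[ i < L ] h (β la i) + h (β mu b)
  β-rotate {L} h b<L = ∑<-rotate L (h ∘ β la) (h ∘ β mu) a≤b b<L
    (λ i i<a → cong (λ p → h (+ p - + suc i)) (before i i<a))
    (λ i a≤i i<b → cong h (β-along i a≤i i<b))
    (λ i b<i → cong (λ p → h (+ p - + suc i)) (after i b<i))

  below-rows : ∀ {L} → AtMostRows L la → b ℕ.< L
  below-rows {L} rows = ℕ.≰⇒> (λ L≤b → ℕ.n≮0 (subst (part mu b ℕ.<_) (rows b L≤b) last))

  ∑β-gap : ∀ {L} → AtMostRows L la → ∑[ i < L ] β la i - ∑[ i < L ] β mu i ≡ β la a - β mu b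
  ∑β-gap {L} rows = begin
    Bλ - Bμ                 ≡⟨ solve 3 (λ x y z → x :- y := (x :+ z) :- y :- z) refl Bλ Bμ (β mu b) ⟩
    Bλ + β mu b - Bμ - β mu b ≡⟨ cong (λ z → z - Bμ - β mu b) (sym (β-rotate (λ x → x) (below-rows rows))) ⟩
    Bμ + β la a - Bμ - β mu b ≡⟨ solve 3 (λ x y z → x :+ y :- x :- z := y :- z) refl Bμ (β la a) (β mu b) ⟩
    β la a - β mu b           ∎
    where
    open ≡-Reasoning
    Bλ = ∑[ i < L ] β la i
    Bμ = ∑[ i < L ] β mu i

  size-gap : ∀ {L} → AtMostRows L la → + size la - + size mu ≡ β la a - β mu b
  size-gap {L} rows = begin
    + size la - + size mu                          ≡⟨ cong₂ _-_ (size≡∑part L la rows) (size≡∑part L mu (AtMostRows-mu rows)) ⟩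
    ∑[ i < L ] (+ part la i) - ∑[ i < L ] (+ part mu i) ≡⟨ cong₂ _-_ (∑part≡∑β+∑suc L la) (∑part≡∑β+∑suc L mu) ⟩
    (Bλ + S) - (Bμ + S)                            ≡⟨ solve 3 (λ x y z → (x :+ z) :- (y :+ z) := x :- y) refl Bλ Bμ S ⟩
    Bλ - Bμ                                        ≡⟨ ∑β-gap rows ⟩
    β la a - β mu b                                ∎
    where
    open ≡-Reasoning
    Bλ = ∑[ i < L ] β la i
    Bμ = ∑[ i < L ] β mu i
    S = ∑[ i < L ] (+ suc i)

  ∑-invariant : ∀ {L} (h : ℤ → ℤ) → AtMostRows L la → h (β mu b) ≡ h (β la a) →
    ∑[ i < L ] h (β mu i) ≡ ∑[ i < L ] h (β la i)
  ∑-invariant {L} h rows hb≡ha = +-cancelʳ (h (β la a)) (∑[ i < L ] h (β mu i)) (∑[ i < L ] h (β la i))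
    (trans (β-rotate h (below-rows rows)) (cong (_+_ (∑[ i < L ] h (β la i))) hb≡ha))

  skew-bounds : ∀ {i j} → InSkew la mu (i , j) → part mu i ℕ.≤ j × j ℕ.< part la i
  skew-bounds (j<λ , j≮μ) = ℕ.≮⇒≥ j≮μ , j<λ

  inSkew : ∀ {i j} → part mu i ℕ.≤ j → j ℕ.< part la i → InSkew la mu (i , j)
  inSkew μ≤j j<λ = j<λ , ℕ.≤⇒≯ μ≤j

  skew-rows : ∀ {i j} → InSkew la mu (i , j) → a ℕ.≤ i × i ℕ.≤ b
  skew-rows sk = rows-within (ℕ.≤-<-trans (proj₁ (skew-bounds sk)) (proj₂ (skew-bounds sk)))

  Path : Cell → Cell → Set
  Path = Star (SkewStep la mu)

  leftward : ∀ {i} d → InSkew la mu (i , part mu i ℕ.+ d) → Path (i , part mu i ℕ.+ d) (i , part mu i)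
  leftward {i} zero    sk rewrite ℕ.+-identityʳ (part mu i) = ε
  leftward {i} (suc d) sk = (sk , sk′ , inj₁ (refl , inj₂ (ℕ.+-suc (part mu i) d))) ◅ leftward d sk′
    where
    sk′ : InSkew la mu (i , part mu i ℕ.+ d)
    sk′ = inSkew (ℕ.m≤m+n _ d) (ℕ.<-trans (ℕ.≤-reflexive (sym (ℕ.+-suc (part mu i) d))) (proj₂ (skew-bounds sk)))

  toRowStart : ∀ {i j} → InSkew la mu (i , j) → Path (i , j) (i , part mu i)
  toRowStart sk with ℕ.m≤n⇒∃[o]m+o≡n (proj₁ (skew-bounds sk))
  ... | d , refl = leftward d sk

  down : ∀ {i} → a ℕ.≤ i → i ℕ.< b → SkewStep la mu (i , part mu i) (suc i , part mu i)
  down {i} a≤i i<b = inSkew ℕ.≤-refl (ℕ.<-≤-trans μ<λ₊ (part-suc≤ pl i)) , inSkew (part-suc≤ pm i) μ<λ₊ , inj₂ (refl , inj₁ refl)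
    where
    μ<λ₊ : part mu i ℕ.< part la (suc i)
    μ<λ₊ = ℕ.≤-reflexive (along i a≤i i<b)

  toCorner : ∀ k {i j} → i ℕ.+ k ≡ b → a ℕ.≤ i → InSkew la mu (i , j) → Path (i , j) (b , part mu b)
  toCorner zero {i} i+0≡b _ sk = subst (λ r → Path _ (r , part mu r)) (trans (sym (ℕ.+-identityʳ i)) i+0≡b) (toRowStart sk)
  toCorner (suc k) {i} i+1+k≡b a≤i sk =
    toRowStart sk ◅◅ (step ◅ toCorner k (trans (sym (ℕ.+-suc i k)) i+1+k≡b) (ℕ.m≤n⇒m≤1+n a≤i) (proj₁ (proj₂ step)))
    where
    step = down a≤i (subst (i ℕ.<_) i+1+k≡b (ℕ.m<m+n i (s≤s z≤n)))

  skewStep-sym : ∀ {c d} → SkewStep la mu c d → SkewStep la mu d c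
  skewStep-sym (c∈ , d∈ , inj₁ (refl , inj₁ e)) = d∈ , c∈ , inj₁ (refl , inj₂ e)
  skewStep-sym (c∈ , d∈ , inj₁ (refl , inj₂ e)) = d∈ , c∈ , inj₁ (refl , inj₁ e)
  skewStep-sym (c∈ , d∈ , inj₂ (refl , inj₁ e)) = d∈ , c∈ , inj₂ (refl , inj₂ e)
  skewStep-sym (c∈ , d∈ , inj₂ (refl , inj₂ e)) = d∈ , c∈ , inj₂ (refl , inj₁ e)

  connected : ∀ c d → InSkew la mu c → InSkew la mu d → Path c d
  connected c d c∈ d∈ = toCorner′ c∈ ◅◅ reverse skewStep-sym (toCorner′ d∈)
    where
    toCorner′ : ∀ {c} → InSkew la mu c → Path c (b , part mu b)
    toCorner′ sk with skew-rows sk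
    ... | a≤i , i≤b with ℕ.m≤n⇒∃[o]m+o≡n i≤b
    ...   | k , i+k≡b = toCorner k i+k≡b a≤i sk

  no-2×2 : ∀ i j → ¬ (InSkew la mu (i , j) × InSkew la mu (suc i , j) × InSkew la mu (i , suc j) × InSkew la mu (suc i , suc j))
  no-2×2 i j (c₀₀ , c₁₀ , _ , c₁₁) =
    ℕ.<-irrefl refl (ℕ.<-≤-trans (proj₂ (skew-bounds c₁₁))
                                  (ℕ.≤-trans (ℕ.≤-reflexive (sym (along i a≤i i<b))) (s≤s (proj₁ (skew-bounds c₀₀)))))
    where
    a≤i = proj₁ (skew-rows c₀₀)
    i<b = proj₂ (skew-rows c₁₀)

  removesRimHook : ∀ {t} → size la ≡ size mu ℕ.+ t → RemoveRimHook t la mu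
  removesRimHook size≡ = pm , μ⊆λ , size≡ , connected , no-2×2

  β-last : ∀ {L t} → AtMostRows L la → size la ≡ size mu ℕ.+ t → β mu b ≡ β la a - + t
  β-last {t = t} rows size≡ = begin
    β mu b                                      ≡⟨ solve 2 (λ x y → y := x :- (x :- y)) refl (β la a) (β mu b) ⟩
    β la a - (β la a - β mu b)                  ≡⟨ cong (_-_ (β la a)) (sym (size-gap rows)) ⟩
    β la a - (+ size la - + size mu)            ≡⟨ cong (λ z → β la a - (z - + size mu)) (trans (cong +_ size≡) (ℤ.pos-+ (size mu) t)) ⟩
    β la a - (+ size mu + + t - + size mu)      ≡⟨ solve 3 (λ x s d → x :- (s :+ d :- s) := x :- d) refl (β la a) (+ size mu) (+ t) ⟩
    β la a - + t                                ∎
    where open ≡-Reasoning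

path-crosses : ∀ {la mu} p {c d} → Star (SkewStep la mu) c d → proj₁ c ℕ.≤ p → p ℕ.< proj₁ d →
               part mu p ℕ.< part la (suc p)
path-crosses p ε c≤p p<c = ⊥-elim (ℕ.<⇒≱ p<c c≤p)
path-crosses {la} {mu} p {i , j} (_◅_ {j = i₂ , j₂} step rest) i≤p p<d with i₂ ℕ.≤? p
... | yes i₂≤p = path-crosses {la} {mu} p rest i₂≤p p<d
... | no  i₂≰p = vertical step (ℕ.≰⇒> i₂≰p)
  where
  vertical : SkewStep la mu (i , j) (i₂ , j₂) → p ℕ.< i₂ → part mu p ℕ.< part la (suc p)
  vertical (_ , _ , inj₁ (refl , _)) p<i = ⊥-elim (ℕ.<⇒≱ p<i i≤p)
  vertical (_ , _ , inj₂ (_ , inj₂ refl)) p<i₂ = ⊥-elim (ℕ.<⇒≱ (ℕ.<-trans p<i₂ ℕ.≤-refl) i≤p)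
  vertical ((_ , j≮μ) , (j<λ₊ , _) , inj₂ (refl , inj₁ refl)) p<1+i with ℕ.≤-antisym i≤p (ℕ.≤-pred p<1+i)
  ... | refl = ℕ.≤-<-trans (ℕ.≮⇒≥ j≮μ) j<λ₊

module _ {t la mu} (pl : IsPartition la) (hook : RemoveRimHook t la mu) where
  private
    pm = proj₁ hook
    μ⊆λ = proj₁ (proj₂ hook)
    size≡ = proj₁ (proj₂ (proj₂ hook))
    connected = proj₁ (proj₂ (proj₂ (proj₂ hook)))
    no-2×2 = proj₂ (proj₂ (proj₂ (proj₂ hook)))

    Shrinks : ℕ → Set
    Shrinks i = part mu i ℕ.< part la i

    Shrinks? : Decidable Shrinks
    Shrinks? i = part mu i ℕ.<? part la i

    beyond : ∀ {L} → AtMostRows L la → ∀ i → L ℕ.≤ i → part mu i ≡ part la i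
    beyond rows i L≤i = trans (ℕ.n≤0⇒n≡0 (subst (part mu i ℕ.≤_) (rows i L≤i) (μ⊆λ i))) (sym (rows i L≤i))

  rimHook-next-row : ∀ p → part la (suc p) ℕ.≤ suc (part mu p)
  rimHook-next-row p with part la (suc p) ℕ.≤? suc (part mu p)
  ... | yes ≤ = ≤
  ... | no  ≰ = ⊥-elim (no-2×2 p j (cell₀ ℕ.≤-refl (ℕ.<-trans ℕ.≤-refl j+1<λ₊) , cell₁ ℕ.≤-refl (ℕ.<-trans ℕ.≤-refl j+1<λ₊) ,
                                    cell₀ (ℕ.n≤1+n j) j+1<λ₊ , cell₁ (ℕ.n≤1+n j) j+1<λ₊))
    where
    j = part mu p
    j+1<λ₊ : suc j ℕ.< part la (suc p)
    j+1<λ₊ = ℕ.≰⇒> ≰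
    cell₀ : ∀ {k} → j ℕ.≤ k → k ℕ.< part la (suc p) → InSkew la mu (p , k)
    cell₀ j≤k k<λ₊ = ℕ.<-≤-trans k<λ₊ (part-suc≤ pl p) , ℕ.≤⇒≯ j≤k
    cell₁ : ∀ {k} → j ℕ.≤ k → k ℕ.< part la (suc p) → InSkew la mu (suc p , k)
    cell₁ j≤k k<λ₊ = k<λ₊ , ℕ.≤⇒≯ (ℕ.≤-trans (part-suc≤ pm p) j≤k)

  rimHook⇒borderStrip : ∀ {L} → 0 ℕ.< t → AtMostRows L la → ∃₂ λ a b → BorderStrip la mu a b
  rimHook⇒borderStrip {L} 0<t rows with ℕ.anyUpTo? Shrinks? L
  ... | no none = ⊥-elim (ℕ.<-irrefl (sym t≡0) 0<t)
    where
    same : ∀ i → part mu i ≡ part la i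
    same i with i ℕ.<? L
    ... | yes i<L = ℕ.≤-antisym (μ⊆λ i) (ℕ.≮⇒≥ (λ μ<λ → none (i , i<L , μ<λ)))
    ... | no  i≮L = beyond rows i (ℕ.≮⇒≥ i≮L)
    t≡0 : t ≡ 0
    t≡0 = ℕ.+-cancelˡ-≡ (size mu) t 0 (trans (sym size≡) (trans (ℤ.+-injective (begin
      + size la                    ≡⟨ size≡∑part L la rows ⟩
      ∑[ i < L ] (+ part la i)     ≡⟨ ∑<-cong L (λ i _ → cong +_ (sym (same i))) ⟩
      ∑[ i < L ] (+ part mu i)     ≡⟨ sym (size≡∑part L mu (λ i L≤i → trans (same i) (rows i L≤i))) ⟩
      + size mu                    ∎)) (sym (ℕ.+-identityʳ (size mu)))))
      where open ≡-Reasoning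
  ... | yes some with least Shrinks? some | greatest Shrinks? some
  ...   | a , _ , μa<λa , below-a | b , b<L , μb<λb , above-b = a , b , record
    { a≤b    = ℕ.≮⇒≥ (λ b<a → below-a b b<a μb<λb)
    ; before = λ i i<a → unshrunk i (below-a i i<a)
    ; along  = λ i a≤i i<b → ℕ.≤-antisym (path-crosses {la} {mu} i (connected _ _ (corner μa<λa) (corner μb<λb)) a≤i i<b)
                                           (rimHook-next-row i)
    ; last   = μb<λb
    ; after  = after
    }
    where
    unshrunk : ∀ i → ¬ Shrinks i → part mu i ≡ part la i
    unshrunk i ¬< = ℕ.≤-antisym (μ⊆λ i) (ℕ.≮⇒≥ ¬<)
    corner : ∀ {i} → Shrinks i → InSkew la mu (i , part mu i)
    corner μ<λ = μ<λ , ℕ.<-irrefl refl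
    after : ∀ i → b ℕ.< i → part mu i ≡ part la i
    after i b<i with i ℕ.<? L
    ... | yes i<L = unshrunk i (above-b i b<i i<L)
    ... | no  i≮L = beyond rows i (ℕ.≮⇒≥ i≮L)

consPositive : ℕ → List ℕ → List ℕ
consPositive zero    _  = []
consPositive (suc x) xs = suc x ∷ xs

toPartition : (ℕ → ℕ) → ℕ → List ℕ
toPartition g zero    = []
toPartition g (suc n) = consPositive (g 0) (toPartition (g ∘ suc) n)

part-toPartition : ∀ n g → Nonincreasing g → (∀ i → n ℕ.≤ i → g i ≡ 0) → ∀ i → part (toPartition g n) i ≡ g i
part-toPartition zero    g dec vanish i = sym (vanish i z≤n)
part-toPartition (suc n) g dec vanish i with g 0 in g0≡
... | zero  = sym (ℕ.n≤0⇒n≡0 (subst (g i ℕ.≤_) g0≡ (nonincreasing-anti dec z≤n)))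
... | suc x with i
...   | zero   = sym g0≡
...   | suc i′ = part-toPartition n (g ∘ suc) (dec ∘ suc) (λ j n≤j → vanish (suc j) (s≤s n≤j)) i′

toPartition-isPartition : ∀ n g → Nonincreasing g → (∀ i → n ℕ.≤ i → g i ≡ 0) → IsPartition (toPartition g n)
toPartition-isPartition zero    g dec vanish = nil
toPartition-isPartition (suc n) g dec vanish with g 0 in g0≡ | toPartition (g ∘ suc) n in tail≡
                                              | toPartition-isPartition n (g ∘ suc) (dec ∘ suc) (λ j n≤j → vanish (suc j) (s≤s n≤j))
... | zero  | _      | _       = nil
... | suc x | []     | _       = one (s≤s z≤n)
... | suc x | y ∷ ys | tail-ok = cons (subst₂ ℕ._≤_ g1≡y g0≡ (dec 0)) tail-ok
  where
  g1≡y : g 1 ≡ y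
  g1≡y = trans (sym (part-toPartition n (g ∘ suc) (dec ∘ suc) (λ j n≤j → vanish (suc j) (s≤s n≤j)) 0)) (cong (λ l → part l 0) tail≡)

-- If β la a − t is not a β-number, a t-rim hook can be removed: it starts in row a and ends
-- in the last row b with β la b > β la a − t, whose new β-number becomes β la a − t.
module HookAtGap {t L la} (0<t : 0 ℕ.< t) (pl : IsPartition la) (rows : AtMostRows L la)
                 (a : ℕ) (a<L : a ℕ.< L) (-L≤y : - + L ℤ.≤ β la a - + t)
                 (gap : ∀ i → i ℕ.< L → β la i ≢ β la a - + t) where

  y : ℤ
  y = β la a - + t

  y<βa : y ℤ.< β la a
  y<βa = ≡+suc⇒< (ℕ.pred t) (trans (solve 2 (λ x s → x := (x :- s) :+ s) refl (β la a) (+ t))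
                                     (cong (λ s → y + + s) (sym (ℕ.suc-pred t {{ℕ.>-nonZero 0<t}}))))

  Above? : Decidable (λ i → y ℤ.< β la i)
  Above? i = y ℤ.<? β la i

  opaque
    boundary : ∃ λ b → b ℕ.< L × y ℤ.< β la b × (∀ i → b ℕ.< i → i ℕ.< L → ¬ y ℤ.< β la i)
    boundary = greatest Above? (a , a<L , y<βa)

  b : ℕ
  b = proj₁ boundary

  y<βb : y ℤ.< β la b
  y<βb = proj₁ (proj₂ (proj₂ boundary))

  beyond-b : ∀ i → b ℕ.< i → i ℕ.< L → ¬ y ℤ.< β la i
  beyond-b = proj₂ (proj₂ (proj₂ boundary))

  a≤b : a ℕ.≤ b
  a≤b = ℕ.≮⇒≥ (λ b<a → beyond-b a b<a a<L y<βa)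

  βb₊<y : β la (suc b) ℤ.< y
  βb₊<y with suc b ℕ.<? L
  ... | yes b₊<L = ℤ.≤∧≢⇒< (ℤ.≮⇒≥ (beyond-b (suc b) ℕ.≤-refl b₊<L))
                           (gap (suc b) b₊<L)
  ... | no  b₊≮L = ℤ.<-≤-trans (β-beyond-< la rows (ℕ.≮⇒≥ b₊≮L)) -L≤y

  positive : ∀ {i} → i ℕ.≤ b → 0 ℕ.< part la i
  positive i≤b = ℕ.<-≤-trans (ℕ.n≢0⇒n>0 λb≢0) (part-anti pl i≤b)
    where
    λb≢0 : part la b ≢ 0
    λb≢0 λb≡0 = ℤ.<⇒≱ y<βb (subst (ℤ._≤ y) βb≡ (ℤ.i<j⇒suc[i]≤j βb₊<y))
      where
      λb₊≡0 : part la (suc b) ≡ 0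
      λb₊≡0 = ℕ.n≤0⇒n≡0 (subst (part la (suc b) ℕ.≤_) λb≡0 (part-suc≤ pl b))
      βb≡ : ℤ.suc (β la (suc b)) ≡ β la b
      βb≡ = begin
        + 1 + (+ part la (suc b) - + suc (suc b))   ≡⟨ cong (λ p → + 1 + (+ p - + suc (suc b))) λb₊≡0 ⟩
        + 1 + (+ 0 - + suc (suc b))
          ≡⟨ solve 1 (λ j → con (+ 1) :+ (con (+ 0) :- (con (+ 2) :+ j)) := con (+ 0) :- (con (+ 1) :+ j)) refl (+ b) ⟩
        + 0 - + suc b                               ≡⟨ cong (λ p → + p - + suc b) (sym λb≡0) ⟩
        β la b                                      ∎
        where open ≡-Reasoning

  w : ℕ
  w = proj₁ (<⇒≡+suc βb₊<y)

  mb : ℕ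
  mb = part la (suc b) ℕ.+ w

  β-mb : + mb - + suc b ≡ y
  β-mb = begin
    + (part la (suc b) ℕ.+ w) - + suc b                ≡⟨ cong (_- + suc b) (ℤ.pos-+ (part la (suc b)) w) ⟩
    + part la (suc b) + + w - + suc b
      ≡⟨ solve 3 (λ p v j → p :+ v :- (con (+ 1) :+ j) := (p :- (con (+ 2) :+ j)) :+ (con (+ 1) :+ v)) refl (+ part la (suc b)) (+ w) (+ b) ⟩
    β la (suc b) + + suc w                             ≡⟨ sym (proj₂ (<⇒≡+suc βb₊<y)) ⟩
    y                                                  ∎
    where open ≡-Reasoning

  mb<λb : mb ℕ.< part la b
  mb<λb = ℤ.drop‿+<+ (subst₂ ℤ._<_ (solve 2 (λ m j → (m :- j) :+ j := m) refl (+ mb) (+ suc b))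
                                     (solve 2 (λ p j → (p :- j) :+ j := p) refl (+ part la b) (+ suc b))
                                     (ℤ.+-monoˡ-< (+ suc b) (subst (ℤ._< β la b) (sym β-mb) y<βb)))

  data Position (i : ℕ) : Set where
    before : i ℕ.< a → Position i
    along  : a ℕ.≤ i → i ℕ.< b → Position i
    last   : i ≡ b → Position i
    after  : b ℕ.< i → Position i

  position : ∀ i → Position i
  position i with ℕ.<-cmp i a | ℕ.<-cmp i b
  ... | tri< i<a _ _ | _            = before i<a
  ... | tri≈ _ i≡a _ | tri< i<b _ _ = along (ℕ.≤-reflexive (sym i≡a)) i<b
  ... | tri> _ _ a<i | tri< i<b _ _ = along (ℕ.<⇒≤ a<i) i<b
  ... | _            | tri≈ _ i≡b _ = last i≡b
  ... | _            | tri> _ _ b<i = after b<i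

  rowAt : ∀ {i} → Position i → ℕ
  rowAt {i} (before _)  = part la i
  rowAt {i} (along _ _) = ℕ.pred (part la (suc i))
  rowAt     (last _)    = mb
  rowAt {i} (after _)   = part la i

  row : ℕ → ℕ
  row i = rowAt (position i)

  row-before : ∀ i → i ℕ.< a → row i ≡ part la i
  row-before i i<a with position i
  ... | before _    = refl
  ... | along a≤i _ = ⊥-elim (ℕ.<⇒≱ i<a a≤i)
  ... | last refl   = ⊥-elim (ℕ.<⇒≱ i<a a≤b)
  ... | after b<i   = ⊥-elim (ℕ.<-asym i<a (ℕ.≤-<-trans a≤b b<i))

  row-along : ∀ i → a ℕ.≤ i → i ℕ.< b → suc (row i) ≡ part la (suc i)
  row-along i a≤i i<b with position i
  ... | before i<a  = ⊥-elim (ℕ.<⇒≱ i<a a≤i)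
  ... | along _ _   = ℕ.suc-pred (part la (suc i)) {{ℕ.>-nonZero (positive i<b)}}
  ... | last refl   = ⊥-elim (ℕ.<-irrefl refl i<b)
  ... | after b<i   = ⊥-elim (ℕ.<-asym i<b b<i)

  row-last : row b ≡ mb
  row-last with position b
  ... | before b<a  = ⊥-elim (ℕ.<⇒≱ b<a a≤b)
  ... | along _ b<b = ⊥-elim (ℕ.<-irrefl refl b<b)
  ... | last _      = refl
  ... | after b<b   = ⊥-elim (ℕ.<-irrefl refl b<b)

  row-after : ∀ i → b ℕ.< i → row i ≡ part la i
  row-after i b<i with position i
  ... | before _    = refl
  ... | along _ i<b = ⊥-elim (ℕ.<-asym i<b b<i)
  ... | last refl   = ⊥-elim (ℕ.<-irrefl refl b<i)
  ... | after _     = refl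

  row-<λ : ∀ i → a ℕ.≤ i → i ℕ.≤ b → row i ℕ.< part la i
  row-<λ i a≤i i≤b with ℕ.m≤n⇒m<n∨m≡n i≤b
  ... | inj₁ i<b  = ℕ.≤-trans (ℕ.≤-reflexive (row-along i a≤i i<b)) (part-suc≤ pl i)
  ... | inj₂ refl = subst (ℕ._< part la b) (sym row-last) mb<λb

  row-≤λ : ∀ i → row i ℕ.≤ part la i
  row-≤λ i with i ℕ.<? a | b ℕ.<? i
  ... | yes i<a | _       = ℕ.≤-reflexive (row-before i i<a)
  ... | no  _   | yes b<i = ℕ.≤-reflexive (row-after i b<i)
  ... | no  i≮a | no  b≮i = ℕ.<⇒≤ (row-<λ i (ℕ.≮⇒≥ i≮a) (ℕ.≮⇒≥ b≮i))

  row-nonincreasing : Nonincreasing row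
  row-nonincreasing i with i ℕ.<? a | i ℕ.<? b
  ... | yes i<a | _       = ℕ.≤-trans (row-≤λ (suc i)) (subst (part la (suc i) ℕ.≤_) (sym (row-before i i<a)) (part-suc≤ pl i))
  ... | no  i≮a | yes i<b = ℕ.≤-pred (subst (row (suc i) ℕ.<_) (sym (row-along i (ℕ.≮⇒≥ i≮a) i<b))
                                        (row-<λ (suc i) (ℕ.m≤n⇒m≤1+n (ℕ.≮⇒≥ i≮a)) i<b))
  ... | no  _   | no  i≮b with ℕ.m≤n⇒m<n∨m≡n (ℕ.≮⇒≥ i≮b)
  ...   | inj₂ refl = subst₂ ℕ._≤_ (sym (row-after (suc b) ℕ.≤-refl)) (sym row-last) (ℕ.m≤m+n (part la (suc b)) w)
  ...   | inj₁ b<i  = subst₂ ℕ._≤_ (sym (row-after (suc i) (ℕ.m≤n⇒m≤1+n b<i))) (sym (row-after i b<i)) (part-suc≤ pl i)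

  row-vanish : ∀ i → L ℕ.≤ i → row i ≡ 0
  row-vanish i L≤i = ℕ.n≤0⇒n≡0 (subst (row i ℕ.≤_) (rows i L≤i) (row-≤λ i))

  mu : List ℕ
  mu = toPartition row L

  part-mu : ∀ i → part mu i ≡ row i
  part-mu = part-toPartition L row row-nonincreasing row-vanish

  strip : BorderStrip la mu a b
  strip = record
    { a≤b    = a≤b
    ; before = λ i i<a → trans (part-mu i) (row-before i i<a)
    ; along  = λ i a≤i i<b → trans (cong suc (part-mu i)) (row-along i a≤i i<b)
    ; last   = subst (ℕ._< part la b) (sym (trans (part-mu b) row-last)) mb<λb
    ; after  = λ i b<i → trans (part-mu i) (row-after i b<i)
    }

  hook : RemoveRimHook t la mu
  hook = removesRimHook (ℤ.+-injective (begin
    + size la                                 ≡⟨ solve 2 (λ x y → x := (x :- y) :+ y) refl (+ size la) (+ size mu) ⟩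
    + size la - + size mu + + size mu          ≡⟨ cong (_+ + size mu) (trans (size-gap rows) βμb) ⟩
    + t + + size mu                            ≡⟨ ℤ.+-comm (+ t) (+ size mu) ⟩
    + (size mu ℕ.+ t)                          ∎))
    where
    open ≡-Reasoning
    open BorderStripProperties pl (toPartition-isPartition L row row-nonincreasing row-vanish) strip
    βμb : β la a - β mu b ≡ + t
    βμb = begin
      β la a - (+ part mu b - + suc b)     ≡⟨ cong (λ p → β la a - (+ p - + suc b)) (trans (part-mu b) row-last) ⟩
      β la a - (+ mb - + suc b)            ≡⟨ cong (_-_ (β la a)) β-mb ⟩
      β la a - (β la a - + t)              ≡⟨ solve 2 (λ x s → x :- (x :- s) := s) refl (β la a) (+ t) ⟩
      + t                                  ∎

t-core-flush : ∀ {t L κ} → 0 ℕ.< t → IsPartition κ → AtMostRows L κ → (∀ mu → ¬ RemoveRimHook t κ mu) →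
  ∀ a → a ℕ.< L → - + L ℤ.≤ β κ a - + t → ∃ λ i → i ℕ.< L × β κ i ≡ β κ a - + t
t-core-flush {t} {L} {κ} 0<t pκ rows core a a<L -L≤y with ℕ.anyUpTo? (λ i → β κ i ℤ.≟ β κ a - + t) L
... | yes found = found
... | no  none  = ⊥-elim (core _ (HookAtGap.hook 0<t pκ rows a a<L -L≤y (λ i i<L eq → none (i , i<L , eq))))

Enumerates : (ℤ → Set) → (ℕ → ℤ) → Set
Enumerates S s = (∀ m → s m ℤ.< s (suc m)) × (∀ r → (S r → ∃ λ m → s m ≡ r) × (∀ m → s m ≡ r → S r))

module Enumeration {S : ℤ → Set} {s : ℕ → ℤ} {n : ℤ} (enum : Enumerates S s) (shift : IsShift s n)
                   (C : ℕ) (beyond-C : ∀ r → + C ℤ.< r → S r) where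

  s-< : ∀ {i j} → i ℕ.< j → s i ℤ.< s j
  s-< {i} {suc j} (s≤s i≤j) with i ℕ.≟ j
  ... | yes refl = proj₁ enum i
  ... | no  i≢j  = ℤ.<-trans (s-< (ℕ.≤∧≢⇒< i≤j i≢j)) (proj₁ enum j)

  s-≤ : ∀ {i j} → i ℕ.≤ j → s i ℤ.≤ s j
  s-≤ {i} {j} i≤j with i ℕ.≟ j
  ... | yes refl = ℤ.≤-refl
  ... | no  i≢j  = ℤ.<⇒≤ (s-< (ℕ.≤∧≢⇒< i≤j i≢j))

  s-<⁻¹ : ∀ {i j} → s i ℤ.< s j → i ℕ.< j
  s-<⁻¹ {i} {j} si<sj = ℕ.≰⇒> (λ j≤i → ℤ.<⇒≱ si<sj (s-≤ j≤i))

  s-injective : ∀ {i j} → s i ≡ s j → i ≡ j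
  s-injective {i} {j} si≡sj with ℕ.<-cmp i j
  ... | tri< i<j _ _ = ⊥-elim (ℤ.<-irrefl si≡sj (s-< i<j))
  ... | tri≈ _ i≡j _ = i≡j
  ... | tri> _ _ j<i = ⊥-elim (ℤ.<-irrefl (sym si≡sj) (s-< j<i))

  s-onto : ∀ {r} → S r → ∃ λ m → s m ≡ r
  s-onto {r} = proj₁ (proj₂ enum r)

  s-into : ∀ m → S (s m)
  s-into m = proj₂ (proj₂ enum (s m)) m refl

  s-≤C+ : ∀ j → s j ℤ.≤ + C + + suc j
  s-≤C+ j with s-onto (beyond-C (+ C + + suc j) (≡+suc⇒< j refl))
  s-≤C+ zero    | m , sm≡ = subst (s 0 ℤ.≤_) sm≡ (s-≤ z≤n)
  s-≤C+ (suc j) | m , sm≡ with m ℕ.≤? j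
  ... | no  m≰j = subst (s (suc j) ℤ.≤_) sm≡ (s-≤ (ℕ.≰⇒> m≰j))
  ... | yes m≤j = ⊥-elim (ℤ.<⇒≱ (≡+suc⇒< 0 step) (subst (ℤ._≤ + C + + suc j) sm≡ (ℤ.≤-trans (s-≤ m≤j) (s-≤C+ j))))
    where
    step : + C + + suc (suc j) ≡ + C + + suc j + + 1
    step = solve 2 (λ c x → c :+ (con (+ 2) :+ x) := c :+ (con (+ 1) :+ x) :+ con (+ 1)) refl (+ C) (+ j)

  n≤C : n ℤ.≤ + C
  n≤C = +-cancelʳ-≤ (+ suc N) (subst (ℤ._≤ + C + + suc N) (proj₂ shift N ℕ.≤-refl) (s-≤C+ N))
    where N = proj₁ shift

  M : ℕ
  M = proj₁ (≤⇒≡+ n≤C)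

  C≡n+M : + C ≡ n + + M
  C≡n+M = proj₂ (≤⇒≡+ n≤C)

  s-pred : ∀ m {r} → S r → s (suc m) ≡ r + + 1 → s m ≡ r
  s-pred m {r} r∈S s₊≡ with s-onto r∈S
  ... | j , refl = ℤ.≤-antisym sm≤sj (s-≤ (ℕ.≤-pred (s-<⁻¹ sj<s₊)))
    where
    sj<s₊ : s j ℤ.< s (suc m)
    sj<s₊ = ≡+suc⇒< 0 s₊≡
    sm≤sj : s m ℤ.≤ s j
    sm≤sj = subst (s m ℤ.≤_) (solve 1 (λ x → x :+ con (+ 1) :- con (+ 1) := x) refl (s j))
                  (<⇒≤-1 (subst (s m ℤ.<_) s₊≡ (proj₁ enum m)))

  s-top : ∀ m → M ℕ.≤ m → s m ≡ n + + suc m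
  s-top m M≤m = descend (proj₁ shift) m M≤m (ℕ.m≤m+n (proj₁ shift) m)
    where
    C< : ∀ m → M ℕ.≤ m → + C ℤ.< n + + suc m
    C< m M≤m with ℕ.m≤n⇒∃[o]m+o≡n M≤m
    ... | d , refl = ≡+suc⇒< d (trans (solve 3 (λ x a b → x :+ (con (+ 1) :+ (a :+ b)) := (x :+ a) :+ (con (+ 1) :+ b)) refl n (+ M) (+ d))
                                      (cong (_+ + suc d) (sym C≡n+M)))
    descend : ∀ e m → M ℕ.≤ m → proj₁ shift ℕ.≤ e ℕ.+ m → s m ≡ n + + suc m
    descend zero    m _   N≤m   = proj₂ shift m N≤m
    descend (suc e) m M≤m N≤e+m = s-pred m (beyond-C _ (C< m M≤m)) (trans s₊≡
      (solve 2 (λ x y → x :+ (con (+ 2) :+ y) := x :+ (con (+ 1) :+ y) :+ con (+ 1)) refl n (+ m)))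
      where
      s₊≡ = descend e (suc m) (ℕ.m≤n⇒m≤1+n M≤m) (subst (proj₁ shift ℕ.≤_) (sym (ℕ.+-suc e m)) N≤e+m)

  s-M : s M ≡ + suc C
  s-M = begin
    s M                 ≡⟨ s-top M ℕ.≤-refl ⟩
    n + + suc M         ≡⟨ solve 2 (λ x m → x :+ (con (+ 1) :+ m) := con (+ 1) :+ (x :+ m)) refl n (+ M) ⟩
    + 1 + (n + + M)     ≡⟨ cong (_+_ (+ 1)) (sym C≡n+M) ⟩
    + suc C             ∎
    where open ≡-Reasoning

  s-below : ∀ m → m ℕ.< M → s m ℤ.≤ + C
  s-below m m<M = subst (s m ℤ.≤_) (solve 1 (λ c → con (+ 1) :+ c :- con (+ 1) := c) refl (+ C))
                        (<⇒≤-1 (subst (s m ℤ.<_) s-M (s-< m<M)))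

-- The t-abacus

-- Level u of runner k is the position pos k u = t·(u − A) + k; the levels u < W = A + C of
-- the t runners cover [−L, t·C), which contains β la i for i < L whenever λ Fits.
module Abacus (t A C : ℕ) (0<t : 0 ℕ.< t) where

  L : ℕ
  L = t ℕ.* A

  W : ℕ
  W = A ℕ.+ C

  level : ℕ → ℤ
  level u = - + A + + u

  pos : ℕ → ℕ → ℤ
  pos k u = + t * level u + + k

  beads : List ℕ → ℤ → ℤ
  beads la = multiplicity L (β la)

  pos-suc : ∀ k u → pos k u + + t ≡ pos k (suc u)
  pos-suc k u = solve 4 (λ T a x y → T :* (:- a :+ x) :+ y :+ T := T :* (:- a :+ (con (+ 1) :+ x)) :+ y) refl (+ t) (+ A) (+ u) (+ k)

  pos-pred : ∀ k u → pos k (suc u) - + t ≡ pos k u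
  pos-pred k u = trans (cong (_- + t) (sym (pos-suc k u))) (solve 2 (λ x s → x :+ s :- s := x) refl (pos k u) (+ t))

  -L≡ : - + L ≡ + t * - + A
  -L≡ = trans (cong -_ (ℤ.pos-* t A)) (ℤ.neg-distribʳ-* (+ t) (+ A))

  -A+W≡C : - + A + + W ≡ + C
  -A+W≡C = trans (cong (_+_ (- + A)) (ℤ.pos-+ A C)) (solve 2 (λ a c → :- a :+ (a :+ c) := c) refl (+ A) (+ C))

  level-< : ∀ {u} → u ℕ.< W → level u ℤ.< + C
  level-< {u} u<W = subst (level u ℤ.<_) -A+W≡C (ℤ.+-monoʳ-< (- + A) (ℤ.+<+ u<W))

  pos-≥ : ∀ k u → - + L ℤ.≤ pos k u
  pos-≥ k u = begin
    - + L                      ≡⟨ -L≡ ⟩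
    + t * - + A                ≤⟨ ℤ.*-monoˡ-≤-nonNeg (+ t) (ℤ.i≤i+j (- + A) (+ u)) ⟩
    + t * level u              ≤⟨ ℤ.i≤i+j (+ t * level u) (+ k) ⟩
    pos k u                    ∎
    where open ℤ.≤-Reasoning

  C≤pos-W : ∀ k → + C ℤ.≤ pos k W
  C≤pos-W k = begin
    + C                        ≡⟨ sym (ℤ.*-identityˡ (+ C)) ⟩
    + 1 * + C                  ≤⟨ ℤ.*-monoʳ-≤-nonNeg (+ C) (ℤ.+≤+ 0<t) ⟩
    + t * + C                  ≡⟨ cong (_*_ (+ t)) (sym -A+W≡C) ⟩
    + t * level W              ≤⟨ ℤ.i≤i+j (+ t * level W) (+ k) ⟩
    pos k W                    ∎
    where open ℤ.≤-Reasoning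

  pos-0-t< : ∀ {k} → k ℕ.< t → pos k 0 - + t ℤ.< - + L
  pos-0-t< {k} k<t = begin-strict
    pos k 0 - + t                  ≡⟨ solve 3 (λ T a y → T :* (:- a :+ con (+ 0)) :+ y :- T := T :* (:- a) :+ (y :- T)) refl (+ t) (+ A) (+ k) ⟩
    + t * - + A + (+ k - + t)      <⟨ ℤ.+-monoʳ-< (+ t * - + A) (ℤ.+-monoˡ-< (- + t) (ℤ.+<+ k<t)) ⟩
    + t * - + A + (+ t - + t)      ≡⟨ solve 2 (λ T a → T :* (:- a) :+ (T :- T) := T :* (:- a)) refl (+ t) (+ A) ⟩
    + t * - + A                    ≡⟨ sym -L≡ ⟩
    - + L                          ∎
    where open ℤ.≤-Reasoning

  onRunner : ℕ → ℤ → ℤ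
  onRunner k x = ∑[ u < W ] δ (pos k u) x

  onRunner-periodic : ∀ {k} → k ℕ.< t → ∀ x → - + L ℤ.≤ x - + t → x ℤ.< + C → onRunner k (x - + t) ≡ onRunner k x
  onRunner-periodic {k} k<t x -L≤x-t x<C = +-cancelˡ (φ 0) (onRunner k (x - + t)) (onRunner k x) (begin
    φ 0 + ∑[ u < W ] δ (pos k u) (x - + t)    ≡⟨ cong (_+_ (φ 0)) (∑<-cong W (λ u _ → shift u)) ⟩
    φ 0 + ∑[ u < W ] φ (suc u)                ≡⟨ sym (∑<-head W φ) ⟩
    ∑< W φ + φ W                              ≡⟨ cong (_+_ (∑< W φ)) (trans φW≡0 (sym φ0≡0)) ⟩
    ∑< W φ + φ 0                              ≡⟨ ℤ.+-comm (∑< W φ) (φ 0) ⟩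
    φ 0 + ∑< W φ                              ∎)
    where
    open ≡-Reasoning
    φ : ℕ → ℤ
    φ u = δ (pos k u) x
    shift : ∀ u → δ (pos k u) (x - + t) ≡ φ (suc u)
    shift u = begin
      δ (pos k u) (x - + t)                ≡⟨ sym (δ-+ (pos k u) (x - + t) (+ t)) ⟩
      δ (pos k u + + t) (x - + t + + t)    ≡⟨ cong₂ δ (pos-suc k u) (solve 2 (λ a b → a :- b :+ b := a) refl x (+ t)) ⟩
      φ (suc u)                            ∎
    φ0≡0 : φ 0 ≡ + 0
    φ0≡0 = δ-≢ (λ eq → ℤ.<⇒≱ (pos-0-t< k<t) (subst (λ z → - + L ℤ.≤ z - + t) (sym eq) -L≤x-t))
    φW≡0 : φ W ≡ + 0
    φW≡0 = δ-≢ (λ eq → ℤ.<⇒≱ x<C (subst (+ C ℤ.≤_) eq (C≤pos-W k)))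

  runnerCount : ℕ → List ℕ → ℤ
  runnerCount k la = ∑[ i < L ] onRunner k (β la i)

  runnerCount≡∑beads : ∀ k la → runnerCount k la ≡ ∑[ u < W ] beads la (pos k u)
  runnerCount≡∑beads k la = ∑<-swap L W (λ i u → δ (pos k u) (β la i))

  record Fits (la : List ℕ) : Set where
    field
      isPartition : IsPartition la
      rows        : AtMostRows L la
      columns     : AtMostColumns C la

  runnerCount-rimHook : ∀ {la mu k} → k ℕ.< t → Fits la → RemoveRimHook t la mu → runnerCount k mu ≡ runnerCount k la
  runnerCount-rimHook {la} {mu} k<t record { isPartition = pl ; rows = rows ; columns = cols } hook with rimHook⇒borderStrip pl hook 0<t rows
  ... | a , b , strip = ∑-invariant (onRunner _) rows (trans (cong (onRunner _) βμb≡) (onRunner-periodic k<t (β la a) -L≤ (β-< la cols a)))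
    where
    open BorderStripProperties pl (proj₁ hook) strip
    βμb≡ : β mu b ≡ β la a - + t
    βμb≡ = β-last rows (proj₁ (proj₂ (proj₂ hook)))
    -L≤ : - + L ℤ.≤ β la a - + t
    -L≤ = subst (- + L ℤ.≤_) βμb≡ (β-≥ mu (below-rows rows))

  fits-rimHook : ∀ {la mu} → Fits la → RemoveRimHook t la mu → Fits mu
  fits-rimHook {mu = mu} fits hook = record
    { isPartition = proj₁ hook
    ; rows        = λ i L≤i → ℕ.n≤0⇒n≡0 (subst (part mu i ℕ.≤_) (Fits.rows fits i L≤i) (proj₁ (proj₂ hook) i))
    ; columns     = λ i → ℕ.≤-trans (proj₁ (proj₂ hook) i) (Fits.columns fits i)
    }

  fits-reachable : ∀ {la κ} → Star (RemoveRimHook t) la κ → Fits la →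
    Fits κ × (∀ k → k ℕ.< t → runnerCount k κ ≡ runnerCount k la)
  fits-reachable ε            fits = fits , λ _ _ → refl
  fits-reachable (hook ◅ rest) fits with fits-reachable rest (fits-rimHook fits hook)
  ... | fitsκ , same = fitsκ , λ k k<t → trans (same k k<t) (runnerCount-rimHook k<t fits hook)

  offset≡pos : ∀ u j → - + L + + (u ℕ.* t ℕ.+ j) ≡ pos j u
  offset≡pos u j = begin
    - + L + + (u ℕ.* t ℕ.+ j)            ≡⟨ cong₂ _+_ -L≡ (trans (ℤ.pos-+ (u ℕ.* t) j) (cong (_+ + j) (ℤ.pos-* u t))) ⟩
    + t * - + A + (+ u * + t + + j)      ≡⟨ solve 4 (λ T a x y → T :* (:- a) :+ (x :* T :+ y) := T :* (:- a :+ x) :+ y) refl (+ t) (+ A) (+ u) (+ j) ⟩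
    pos j u                              ∎
    where open ≡-Reasoning

  ∑β-by-runners : ∀ la (h : ℤ → ℤ) → AtMostColumns C la →
    ∑[ i < L ] h (β la i) ≡ sumFin t (λ j → ∑[ u < W ] (beads la (pos (toℕ j) u) * h (pos (toℕ j) u)))
  ∑β-by-runners la h cols = begin
    ∑[ i < L ] h (β la i)                                        ≡⟨ ∑<-by-multiplicity L (β la) h (- + L) (W ℕ.* t) inWindow ⟩
    ∑[ v < W ℕ.* t ] F (- + L + + v)                             ≡⟨ ∑<-blocks t W (λ v → F (- + L + + v)) ⟩
    ∑[ u < W ] ∑[ j < t ] F (- + L + + (u ℕ.* t ℕ.+ j))          ≡⟨ ∑<-cong W (λ u _ → ∑<-cong t (λ j _ → cong F (offset≡pos u j))) ⟩
    ∑[ u < W ] ∑[ j < t ] F (pos j u)                            ≡⟨ ∑<-cong W (λ u _ → sym (sumFin-toℕ t (λ j → F (pos j u)))) ⟩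
    ∑[ u < W ] sumFin t (λ j → F (pos (toℕ j) u))                ≡⟨ sym (sumFin-∑< t W (λ j u → F (pos (toℕ j) u))) ⟩
    sumFin t (λ j → ∑[ u < W ] F (pos (toℕ j) u))                ∎
    where
    open ≡-Reasoning
    F : ℤ → ℤ
    F x = beads la x * h x
    inWindow : ∀ i → i ℕ.< L → InWindow (- + L) (W ℕ.* t) (β la i)
    inWindow i i<L = β-≥ la i<L , ℤ.<-≤-trans (β-< la cols i)
                       (subst (+ C ℤ.≤_) (trans (sym (offset≡pos W 0)) (cong (λ v → - + L + + v) (ℕ.+-identityʳ (W ℕ.* t)))) (C≤pos-W 0))

  beads-present : ∀ {la x} → IsPartition la → ∀ i → i ℕ.< L → β la i ≡ x → beads la x ≡ + 1
  beads-present {la} pl i i<L βi≡x = multiplicity-unique L (β la) _ i i<L βi≡x (λ j _ βj≡x → β-injective pl (trans βj≡x (sym βi≡x)))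

  beads-absent : ∀ la {x} → (∀ i → i ℕ.< L → β la i ≢ x) → beads la x ≡ + 0
  beads-absent la {x} none = multiplicity-absent L (β la) x none

module CoreRunners (t A C : ℕ) (0<t : 0 ℕ.< t) {κ} (fits : Abacus.Fits t A C 0<t κ)
                   (core : ∀ mu → ¬ RemoveRimHook t κ mu) where
  open Abacus t A C 0<t

  open Fits fits renaming (isPartition to pκ)

  beads-bit : ∀ x → beads κ x ≡ + 0 ⊎ beads κ x ≡ + 1
  beads-bit x with ℕ.anyUpTo? (λ i → β κ i ℤ.≟ x) L
  ... | yes (i , i<L , βi≡x) = inj₂ (beads-present pκ i i<L βi≡x)
  ... | no  none             = inj₁ (beads-absent κ (λ i i<L βi≡x → none (i , i<L , βi≡x)))

  bead-at : ∀ {x} → beads κ x ≡ + 1 → ∃ λ i → i ℕ.< L × β κ i ≡ x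
  bead-at {x} bead with ℕ.anyUpTo? (λ i → β κ i ℤ.≟ x) L
  ... | yes found = found
  ... | no  none  with trans (sym bead) (beads-absent κ (λ i i<L βi≡x → none (i , i<L , βi≡x)))
  ...   | ()

  beads-downward : ∀ k u → beads κ (pos k (suc u)) ≡ + 1 → beads κ (pos k u) ≡ + 1
  beads-downward k u bead with bead-at bead
  ... | i , i<L , βi≡
      with t-core-flush 0<t pκ rows core i i<L (subst (λ x → - + L ℤ.≤ x - + t) (sym βi≡) (subst (- + L ℤ.≤_) (sym (pos-pred k u)) (pos-≥ k u)))
  ...   | j , j<L , βj≡ = beads-present pκ j j<L (trans βj≡ (trans (cong (_- + t) βi≡) (pos-pred k u)))

  module _ (k : ℕ) where
    private
      packed = ∑<-downward-closed W (λ u → beads κ (pos k u)) (λ u _ → beads-bit (pos k u)) (λ u _ → beads-downward k u)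

    filled : ℕ
    filled = proj₁ packed

    runnerSum-core : ∀ (h : ℤ → ℤ) → ∑[ u < W ] (beads κ (pos k u) * h (pos k u)) ≡ ∑[ u < filled ] h (pos k u)
    runnerSum-core h = proj₂ packed (h ∘ pos k)

    runnerCount-core : runnerCount k κ ≡ + filled
    runnerCount-core = begin
      runnerCount k κ                                 ≡⟨ runnerCount≡∑beads k κ ⟩
      ∑[ u < W ] beads κ (pos k u)                    ≡⟨ ∑<-cong W (λ u _ → sym (ℤ.*-identityʳ _)) ⟩
      ∑[ u < W ] (beads κ (pos k u) * + 1)            ≡⟨ runnerSum-core (λ _ → + 1) ⟩
      ∑[ u < filled ] (+ 1)                           ≡⟨ ∑<-one filled ⟩
      + filled                                        ∎
      where open ≡-Reasoning

module EnumeratedRunner (t A C : ℕ) (0<t : 0 ℕ.< t) {π} (fits : Abacus.Fits t A C 0<t π) {k} (k<t : k ℕ.< t)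
                        {s n} (enum : IsEnumeration t π k s) (shift : IsShift s n) where
  open Abacus t A C 0<t

  open Fits fits renaming (isPartition to pπ; columns to cols)

  InS-above : ∀ r → + C ℤ.< r → InS t π k r
  InS-above r C<r (i , βi≡) = ℤ.<⇒≱ (β-< π cols i) (subst (+ C ℤ.≤_) (sym βi≡) (begin
    + C                          ≤⟨ <⇒≤-1 C<r ⟩
    r - + 1                      ≡⟨ sym (ℤ.*-identityˡ (r - + 1)) ⟩
    + 1 * (r - + 1)              ≤⟨ ℤ.*-monoʳ-≤-nonNeg (r - + 1) {{ℤ.nonNegative 0≤r-1}} (ℤ.+≤+ 0<t) ⟩
    + t * (r - + 1)              ≤⟨ ℤ.i≤i+j (+ t * (r - + 1)) (+ k) ⟩
    + t * (r - + 1) + + k        ∎))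
    where
    open ℤ.≤-Reasoning
    0≤r-1 : + 0 ℤ.≤ r - + 1
    0≤r-1 = ℤ.≤-trans (ℤ.+≤+ z≤n) (<⇒≤-1 C<r)

  InS⇒-A< : ∀ r → InS t π k r → - + A ℤ.< r
  InS⇒-A< r ins = ℤ.≰⇒> (λ r≤-A → ins (InBeta-below π rows _ (begin-strict
    + t * (r - + 1) + + k                 <⟨ ℤ.+-mono-≤-< (ℤ.*-monoˡ-≤-nonNeg (+ t) (ℤ.+-monoˡ-≤ (- + 1) r≤-A)) (ℤ.+<+ k<t) ⟩
    + t * (- + A - + 1) + + t             ≡⟨ solve 2 (λ T a → T :* (:- a :- con (+ 1)) :+ T := T :* (:- a)) refl (+ t) (+ A) ⟩
    + t * - + A                           ≡⟨ sym -L≡ ⟩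
    - + L                                 ∎)))
    where open ℤ.≤-Reasoning

  open Enumeration {InS t π k} {s} {n} enum shift C InS-above public

  gaps : ℤ → ℤ
  gaps = multiplicity M (λ m → s m - + 1)

  position-of-level : ∀ c → + t * (+ 1 + c - + 1) + + k ≡ + t * c + + k
  position-of-level c = cong (λ x → + t * x + + k) (solve 1 (λ x → con (+ 1) :+ x :- con (+ 1) := x) refl c)

  bead-or-gap : ∀ u → u ℕ.< W → beads π (pos k u) ≡ + 1 - gaps (level u)
  bead-or-gap u u<W with ℕ.anyUpTo? (λ i → β π i ℤ.≟ pos k u) L
  ... | yes (i , i<L , βi≡) = trans (beads-present pπ i i<L βi≡) (cong (_-_ (+ 1)) (sym (multiplicity-absent M _ (level u) no-gap)))
    where
    no-gap : ∀ m → m ℕ.< M → s m - + 1 ≢ level u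
    no-gap m _ sm-1≡c = s-into m (i , trans βi≡ (cong (λ c → + t * c + + k) (sym sm-1≡c)))
  ... | no none with s-onto ins
    where
    ins : InS t π k (+ 1 + level u)
    ins inβ with InBeta⇒index π rows (pos-≥ k u) (subst (InBeta π) (position-of-level (level u)) inβ)
    ... | i , i<L , βi≡ = none (i , i<L , βi≡)
  ...   | m , sm≡ = trans (beads-absent π (λ i i<L βi≡ → none (i , i<L , βi≡))) (cong (_-_ (+ 1)) (sym one-gap))
    where
    sm-1≡ : s m - + 1 ≡ level u
    sm-1≡ = trans (cong (_- + 1) sm≡) (solve 1 (λ x → con (+ 1) :+ x :- con (+ 1) := x) refl (level u))
    m<M : m ℕ.< M
    m<M = s-<⁻¹ (subst₂ ℤ._<_ (sym sm≡) (sym s-M) (ℤ.+-monoʳ-< (+ 1) (level-< u<W)))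
    one-gap : gaps (level u) ≡ + 1
    one-gap = multiplicity-unique M _ (level u) m m<M sm-1≡
                (λ m′ _ sm′-1≡ → s-injective (+-cancelʳ (- + 1) (s m′) (s m) (trans sm′-1≡ (sym sm-1≡))))

  gap-in-window : ∀ m → m ℕ.< M → InWindow (- + A) W (s m - + 1)
  gap-in-window m m<M =
    <⇒≤-1 (InS⇒-A< (s m) (s-into m)) ,
    subst (s m - + 1 ℤ.<_) (sym -A+W≡C)
          (ℤ.<-≤-trans (≡+suc⇒< 0 (solve 1 (λ x → x := x :- con (+ 1) :+ con (+ 1)) refl (s m))) (s-below m m<M))

  runnerSum-enumerated : ∀ (h : ℤ → ℤ) →
    ∑[ u < W ] (beads π (pos k u) * h (level u)) ≡ ∑[ u < W ] h (level u) - ∑[ m < M ] h (s m - + 1)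
  runnerSum-enumerated h = begin
    ∑[ u < W ] (beads π (pos k u) * h (level u))                   ≡⟨ ∑<-cong W (λ u u<W → complement u u<W) ⟩
    ∑[ u < W ] (h (level u) - gaps (level u) * h (level u))         ≡⟨ ∑<-- W (h ∘ level) (λ u → gaps (level u) * h (level u)) ⟩
    ∑[ u < W ] h (level u) - ∑[ u < W ] (gaps (level u) * h (level u))
      ≡⟨ cong (_-_ (∑[ u < W ] h (level u))) (sym (∑<-by-multiplicity M (λ m → s m - + 1) h (- + A) W gap-in-window)) ⟩
    ∑[ u < W ] h (level u) - ∑[ m < M ] h (s m - + 1)               ∎
    where
    open ≡-Reasoning
    complement : ∀ u → u ℕ.< W → beads π (pos k u) * h (level u) ≡ h (level u) - gaps (level u) * h (level u)
    complement u u<W = begin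
      beads π (pos k u) * h (level u)                       ≡⟨ cong (_* h (level u)) (bead-or-gap u u<W) ⟩
      (+ 1 - gaps (level u)) * h (level u)                  ≡⟨ solve 2 (λ g x → (con (+ 1) :- g) :* x := x :- g :* x) refl (gaps (level u)) (h (level u)) ⟩
      h (level u) - gaps (level u) * h (level u)            ∎

  runnerCount-enumerated : runnerCount k π ≡ + W - + M
  runnerCount-enumerated = begin
    runnerCount k π                                     ≡⟨ runnerCount≡∑beads k π ⟩
    ∑[ u < W ] beads π (pos k u)                        ≡⟨ ∑<-cong W (λ u _ → sym (ℤ.*-identityʳ _)) ⟩
    ∑[ u < W ] (beads π (pos k u) * + 1)                ≡⟨ runnerSum-enumerated (λ _ → + 1) ⟩
    ∑[ u < W ] (+ 1) - ∑[ m < M ] (+ 1)                 ≡⟨ cong₂ _-_ (∑<-one W) (∑<-one M) ⟩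
    + W - + M                                           ∎
    where open ≡-Reasoning

-- Comparing π with its t-core runner by runner

negOnePow-runner-difference : ∀ t → Odd t → ∀ k n s m →
  negOnePow (+ t * (n + + m) + + k) - negOnePow (+ t * (s - + 1) + + k) ≡
  negOnePow (+ k + n) * (negOnePowℕ m * (+ 1 - negOnePow (n + + suc m - s)))
negOnePow-runner-difference t odd k n s m = begin
  negOnePow (+ t * (n + + m) + + k) - negOnePow (+ t * (s - + 1) + + k)
    ≡⟨ cong₂ _-_ (trans (negOnePow-+ (+ t * (n + + m)) (+ k)) (cong (_* c) (trans (negOnePow-odd-* t odd (n + + m)) (negOnePow-+ n (+ m)))))
                 (trans (negOnePow-+ (+ t * (s - + 1)) (+ k)) (cong (_* c) (trans (negOnePow-odd-* t odd (s - + 1)) (negOnePow-+ s (- + 1))))) ⟩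
  a * b * c - d * - + 1 * c
    ≡⟨ solve 4 (λ a b c d → a :* b :* c :- d :* (:- con (+ 1)) :* c := c :* a :* b :+ con (+ 1) :* con (+ 1) :* (c :* d)) refl a b c d ⟩
  c * a * b + + 1 * + 1 * (c * d)
    ≡⟨ cong₂ (λ x y → c * a * b + x * y * (c * d)) (sym (negOnePow-square n)) (sym (negOnePowℕ-square m)) ⟩
  c * a * b + a * a * (b * b) * (c * d)
    ≡⟨ solve 4 (λ a b c d → c :* a :* b :+ a :* a :* (b :* b) :* (c :* d) := c :* a :* (b :* (con (+ 1) :- a :* (:- b) :* d))) refl a b c d ⟩
  c * a * (b * (+ 1 - a * - b * d))
    ≡⟨ cong₂ (λ x y → x * (b * (+ 1 - y))) (sym (negOnePow-+ (+ k) n)) (sym gap-sign) ⟩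
  negOnePow (+ k + n) * (b * (+ 1 - negOnePow (n + + suc m - s)))
    ∎
  where
  open ≡-Reasoning
  a = negOnePow n
  b = negOnePowℕ m
  c = negOnePow (+ k)
  d = negOnePow s
  gap-sign : negOnePow (n + + suc m - s) ≡ a * - b * d
  gap-sign = trans (negOnePow-+ (n + + suc m) (- s)) (cong₂ _*_ (negOnePow-+ n (+ suc m)) (negOnePow-neg s))

module RunnerComparison (t A C : ℕ) (odd : Odd t) (0<t : 0 ℕ.< t) {π κ}
                        (fitsπ : Abacus.Fits t A C 0<t π) (fitsκ : Abacus.Fits t A C 0<t κ)
                        (core : ∀ mu → ¬ RemoveRimHook t κ mu)
                        {k} (k<t : k ℕ.< t) {s n} (enum : IsEnumeration t π k s) (shift : IsShift s n)
                        {q} (quotient : IsQuotientPart s n q)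
                        (same : Abacus.runnerCount t A C 0<t k κ ≡ Abacus.runnerCount t A C 0<t k π) where
  open Abacus t A C 0<t
  open EnumeratedRunner t A C 0<t fitsπ k<t {s} {n} enum shift
  open CoreRunners t A C 0<t fitsκ core

  e : ℕ
  e = filled k

  e≡W-M : + e ≡ + W - + M
  e≡W-M = trans (sym (runnerCount-core k)) (trans same runnerCount-enumerated)

  W≡e+M : W ≡ e ℕ.+ M
  W≡e+M = ℤ.+-injective (begin
    + W                ≡⟨ solve 2 (λ w m → w := (w :- m) :+ m) refl (+ W) (+ M) ⟩
    + W - + M + + M    ≡⟨ cong (_+ + M) (sym e≡W-M) ⟩
    + e + + M          ∎)
    where open ≡-Reasoning

  level-filled : ∀ m → level (e ℕ.+ m) ≡ n + + m
  level-filled m = begin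
    - + A + + (e ℕ.+ m)                  ≡⟨ cong (_+_ (- + A)) (ℤ.pos-+ e m) ⟩
    - + A + (+ e + + m)                  ≡⟨ cong (λ x → - + A + (x + + m)) (trans e≡W-M (cong (_- + M) (ℤ.pos-+ A C))) ⟩
    - + A + (+ A + + C - + M + + m)      ≡⟨ cong (λ c → - + A + (+ A + c - + M + + m)) C≡n+M ⟩
    - + A + (+ A + (n + + M) - + M + + m) ≡⟨ solve 4 (λ a x y z → :- a :+ (a :+ (x :+ y) :- y :+ z) := x :+ z) refl (+ A) n (+ M) (+ m) ⟩
    n + + m                              ∎
    where open ≡-Reasoning

  q-rows : AtMostRows M q
  q-rows m M≤m = ℤ.+-injective (trans (proj₂ quotient m) (trans (cong (_-_ (n + + suc m)) (s-top m M≤m)) (ℤ.+-inverseʳ (n + + suc m))))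

  runnerSum : List ℕ → ℤ
  runnerSum la = ∑[ u < W ] (beads la (pos k u) * negOnePow (pos k u))

  runner-gap : runnerSum π ≡ runnerSum κ + + 2 * (negOnePow (+ k + n) * BGrank q)
  runner-gap = begin
    runnerSum π                                          ≡⟨ runnerSum-enumerated h ⟩
    ∑< W H - G                                           ≡⟨ cong (λ w → ∑< w H - G) W≡e+M ⟩
    ∑< (e ℕ.+ M) H - G                                   ≡⟨ cong (_- G) (∑<-split e M H) ⟩
    ∑< e H + ∑[ m < M ] H (e ℕ.+ m) - G                   ≡⟨ ℤ.+-assoc (∑< e H) (∑[ m < M ] H (e ℕ.+ m)) (- G) ⟩
    ∑< e H + (∑[ m < M ] H (e ℕ.+ m) - G)
      ≡⟨ cong₂ _+_ (sym (runnerSum-core k negOnePow)) (sym (∑<-- M (λ m → H (e ℕ.+ m)) (λ m → h (s m - + 1)))) ⟩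
    runnerSum κ + ∑[ m < M ] (H (e ℕ.+ m) - h (s m - + 1)) ≡⟨ cong (_+_ (runnerSum κ)) (∑<-cong M (λ m _ → step m)) ⟩
    runnerSum κ + ∑[ m < M ] (σ * (negOnePowℕ m * (+ 1 - negOnePowℕ (part q m))))
                                                         ≡⟨ cong (_+_ (runnerSum κ)) (∑<-*ˡ M σ _) ⟩
    runnerSum κ + σ * ∑[ m < M ] (negOnePowℕ m * (+ 1 - negOnePowℕ (part q m)))
                                                         ≡⟨ cong (λ x → runnerSum κ + σ * x) (sym (twice-bgFrom M 0 q q-rows)) ⟩
    runnerSum κ + σ * (+ 2 * BGrank q)
      ≡⟨ cong (_+_ (runnerSum κ)) (solve 2 (λ x y → x :* (con (+ 2) :* y) := con (+ 2) :* (x :* y)) refl σ (BGrank q)) ⟩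
    runnerSum κ + + 2 * (σ * BGrank q)                    ∎
    where
    open ≡-Reasoning
    h : ℤ → ℤ
    h c = negOnePow (+ t * c + + k)
    H : ℕ → ℤ
    H u = h (level u)
    G : ℤ
    G = ∑[ m < M ] h (s m - + 1)
    σ : ℤ
    σ = negOnePow (+ k + n)
    step : ∀ m → H (e ℕ.+ m) - h (s m - + 1) ≡ σ * (negOnePowℕ m * (+ 1 - negOnePowℕ (part q m)))
    step m = begin
      H (e ℕ.+ m) - h (s m - + 1)      ≡⟨ cong (λ c → h c - h (s m - + 1)) (level-filled m) ⟩
      h (n + + m) - h (s m - + 1)      ≡⟨ negOnePow-runner-difference t odd k n (s m) m ⟩
      σ * (negOnePowℕ m * (+ 1 - negOnePow (n + + suc m - s m)))
                                       ≡⟨ cong (λ x → σ * (negOnePowℕ m * (+ 1 - negOnePow x))) (sym (proj₂ quotient m)) ⟩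
      σ * (negOnePowℕ m * (+ 1 - negOnePowℕ (part q m))) ∎

odd⇒positive : ∀ {t} → Odd t → 0 ℕ.< t
odd⇒positive {suc t} _ = s≤s z≤n

module SignedBetaSums {t} (odd : Odd t) {π κ} (pπ : IsPartition π) (tcore : IsTCoreOf t π κ)
                      {s : Fin t → ℕ → ℤ} {n : Fin t → ℤ} {q : Fin t → List ℕ}
                      (enum : ∀ k → IsEnumeration t π (toℕ k) (s k)) (shift : ∀ k → IsShift (s k) (n k))
                      (quotient : ∀ k → IsQuotientPart (s k) (n k) (q k)) where
  open Abacus t (length π) (part π 0) (odd⇒positive odd) public

  fitsπ : Fits π
  fitsπ = record
    { isPartition = pπ
    ; rows        = λ i L≤i → AtMostRows-length π i (ℕ.≤-trans (ℕ.m≤n*m (length π) t {{ℕ.>-nonZero (odd⇒positive odd)}}) L≤i)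
    ; columns     = λ i → part-anti pπ z≤n
    }

  reached : Fits κ × (∀ k → k ℕ.< t → runnerCount k κ ≡ runnerCount k π)
  reached = fits-reachable (proj₁ tcore) fitsπ

  fitsκ : Fits κ
  fitsκ = proj₁ reached

  quotientSum : ℤ
  quotientSum = sumFin t (λ j → negOnePow (+ toℕ j + n j) * BGrank (q j))

  ∑sign-β-gap : ∑[ i < L ] negOnePow (β π i) ≡ ∑[ i < L ] negOnePow (β κ i) + + 2 * quotientSum
  ∑sign-β-gap = begin
    ∑[ i < L ] negOnePow (β π i)                                  ≡⟨ ∑β-by-runners π negOnePow (Fits.columns fitsπ) ⟩
    sumFin t (λ j → runnerSum j π)                                ≡⟨ sumFin-cong t (λ j → Comparison.runner-gap j) ⟩
    sumFin t (λ j → runnerSum j κ + + 2 * term j)                 ≡⟨ sumFin-+ t (λ j → runnerSum j κ) (λ j → + 2 * term j) ⟩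
    sumFin t (λ j → runnerSum j κ) + sumFin t (λ j → + 2 * term j) ≡⟨ cong₂ _+_ (sym (∑β-by-runners κ negOnePow (Fits.columns fitsκ)))
                                                                                (sumFin-*ˡ t (+ 2) term) ⟩
    ∑[ i < L ] negOnePow (β κ i) + + 2 * quotientSum               ∎
    where
    open ≡-Reasoning
    module Comparison (j : Fin t) = RunnerComparison t (length π) (part π 0) odd (odd⇒positive odd) fitsπ fitsκ (proj₂ tcore)
      (Fin.toℕ<n j) {s j} {n j} (enum j) (shift j) (quotient j) (proj₂ reached (toℕ j) (Fin.toℕ<n j))
    open Comparison using (runnerSum)
    term : Fin t → ℤ
    term j = negOnePow (+ toℕ j + n j) * BGrank (q j)

mainTheorem7 : (t : ℕ) → Odd t →
    (π κ : List ℕ) → IsPartition π → IsTCoreOf t π κ →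
    (s : Fin t → ℕ → ℤ) → (n : Fin t → ℤ) → (q : Fin t → List ℕ) →
    (∀ k → IsEnumeration t π (toℕ k) (s k)) →
    (∀ k → IsShift (s k) (n k)) →
    (∀ k → IsQuotientPart (s k) (n k) (q k)) →
    BGrank π ≡ BGrank κ + sumFin t (λ j → negOnePow (+ toℕ j + n j) * BGrank (q j))
mainTheorem7 t odd π κ pπ tcore s n q enum shift quotient = ℤ.*-cancelˡ-≡ (+ 2) _ _ (begin
  + 2 * BGrank π                            ≡⟨ twice-BGrank L π (Fits.rows fitsπ) ⟩
  V + ∑[ i < L ] negOnePow (β π i)          ≡⟨ cong (_+_ V) ∑sign-β-gap ⟩
  V + (∑[ i < L ] negOnePow (β κ i) + + 2 * quotientSum)
    ≡⟨ sym (ℤ.+-assoc V (∑[ i < L ] negOnePow (β κ i)) (+ 2 * quotientSum)) ⟩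
  V + ∑[ i < L ] negOnePow (β κ i) + + 2 * quotientSum
    ≡⟨ cong (_+ + 2 * quotientSum) (sym (twice-BGrank L κ (Fits.rows fitsκ))) ⟩
  + 2 * BGrank κ + + 2 * quotientSum        ≡⟨ sym (ℤ.*-distribˡ-+ (+ 2) (BGrank κ) quotientSum) ⟩
  + 2 * (BGrank κ + quotientSum)            ∎)
  where
  open SignedBetaSums odd pπ tcore {s} {n} {q} enum shift quotient
  open ≡-Reasoning
  V : ℤ
  V = ∑[ u < L ] negOnePowℕ u
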